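{- Let $\alpha$ be a positive integer and let $p\ge 5$ be a prime such that the Legendre symbol satisfies $\left(\frac{ -\alpha}{p}\right)=-1$. Then for every integer $\beta\ge 0$, $$\sum_{n\ge 0} Q_{4\alpha}^{\alpha}\!\left(p^{2\beta}n+\frac{(\alpha+1)(p^{2\beta}-1)}{24}\right)q^n \equiv f_1 f_{\alpha} \pmod 2,$$ and for every integer $n\ge 0$ and every $j$ with $1\le j\le p-1$, $$Q_{4\alpha}^{\alpha}\!\left(p^{2\beta+1}(pn+j)+\frac{(\alpha+1)(p^{2\beta+2}-1)}{24}\right)\equiv 0 \pmod 2.$$
   Context: For positive integers $s,t$, the numbers $Q_t^s(n)$ ($n\ge 0$) are defined by the generating function $$\sum_{n\ge 0}Q_t^s(n)q^n=\frac{(-q;q)_\infty}{(-q^s;q^t)_\infty(-q^{t-s};q^t)_\infty},$$ where $(a;q)_\infty=\prod_{k\ge 0}(1-aq^k)$. Combinatorially, $Q_t^s(n)$ is the number of partitions of $n$ into distinct parts with no part congruent to $s$ or $t-s$ modulo $t$. For a positive integer $k$, $f_k=\prod_{m\ge 1}(1-q^{km})$. A congruence between power series modulo $M$ means coefficientwise congruence. -}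

module Defs where

open import Data.Nat as ℕ using (ℕ; zero; suc; _∸_; _≤?_)
open import Data.Nat.Divisibility as ℕD using ()
open import Data.Integer as ℤ using (ℤ; +_; -_; _-_; ∣_∣)
open import Data.Integer.Divisibility as ℤD using ()
open import Relation.Nullary using (Dec; yes; no; ¬_)
open import Data.Sum using (_⊎_; inj₁; inj₂)

infix 4 _≡_[mod_]
_≡_[mod_] : ℤ → ℤ → ℕ → Set
a ≡ b [mod t ] = (+ t) ℤD.∣ (a - b)

≡-mod? : (a b : ℤ) (t : ℕ) → Dec (a ≡ b [mod t ])
≡-mod? a b t = t ℕD.∣? ∣ a - b ∣

allowed : ℕ → ℕ → ℕ → Set
allowed t s m = ¬ ((+ m ≡ + s [mod t ]) ⊎ (+ m ≡ (+ t - + s) [mod t ]))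

allowed? : (t s m : ℕ) → Dec (allowed t s m)
allowed? t s m with ≡-mod? (+ m) (+ s) t | ≡-mod? (+ m) (+ t - + s) t
... | yes p | _     = no (λ f → f (inj₁ p))
... | no _  | yes q = no (λ f → f (inj₂ q))
... | no p  | no q  = yes λ { (inj₁ x) → p x ; (inj₂ y) → q y }

-- number of partitions of r into distinct allowed parts, all parts ≤ m
cnt : (t s : ℕ) → ℕ → ℕ → ℕ
cnt t s zero zero = 1
cnt t s zero (suc _) = 0
cnt t s (suc m) r with allowed? t s (suc m) | suc m ≤? r
... | yes _ | yes _ = cnt t s m r ℕ.+ cnt t s m (r ∸ suc m)
... | _     | _     = cnt t s m r

Q : (t s n : ℕ) → ℕ
Q t s n = cnt t s n n

Series : Set
Series = ℕ → ℤ

convAux : Series → Series → ℕ → ℕ → ℤ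
convAux a b n zero = + 0
convAux a b n (suc k) = convAux a b n k ℤ.+ a k ℤ.* b (n ∸ k)

_⋆_ : Series → Series → Series
(a ⋆ b) n = convAux a b n (suc n)

oneMinus : ℕ → Series
oneMinus d n with n ℕ.≟ 0 | n ℕ.≟ d
... | yes _ | _ = + 1
... | no _ | yes _ = - (+ 1)
... | no _ | no _ = + 0

fprod : ℕ → ℕ → Series
fprod k zero = λ n → + (if' n)
  where
    if' : ℕ → ℕ
    if' zero = 1
    if' (suc _) = 0
fprod k (suc N) = fprod k N ⋆ oneMinus (k ℕ.* suc N)

-- f_k = ∏_{m≥1} (1 - q^{k m}); for k ≥ 1 the coefficient of q^n only
-- involves the factors with m ≤ n.
f : ℕ → Series
f k n = fprod k n n

LegendreIsMinusOne : ℤ → ℕ → Set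
LegendreIsMinusOne a p = (x : ℤ) → ¬ (x ℤ.* x ≡ a [mod p ])

-- Modulo 2, (-q;q)∞ ≡ f₁, while the excluded parts contribute
-- (-q^α;q^{4α})∞ (-q^{3α};q^{4α})∞ = ∏_{j odd} (1 + q^{αj}) ≡ f_α / f_{2α} ≡ 1 / f_α, so Σ Q_{4α}^α(n) qⁿ ≡ f₁ f_α.
-- By Euler's pentagonal theorem (in Shanks' finite form), f_d ≡ Σ q^{d(x²−1)/24} over the x > 0 coprime to 6;
-- hence Q_{4α}^α(n) and the coefficient of qⁿ in f₁ f_α are both congruent to the number of pairs (x, y) of
-- positive integers coprime to 6 with x² + αy² = 24n + α + 1.  When (−α/p) = −1, p ∣ x² + αy² forces p ∣ x and
-- p ∣ y, so this number is unchanged when 24n + α + 1 is multiplied by p², and it vanishes when p divides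
-- 24n + α + 1 exactly once.  For the indices of the theorem, 24n + α + 1 becomes p^{2β} (24n + α + 1),
-- respectively p^{2β} · p · (24(pn + j) + (α + 1)p) with p ∤ 24(pn + j) + (α + 1)p.

module Submission where

open import Algebra.Bundles using (CommutativeRing)
open import Data.Bool using (Bool; true; false; _xor_; _∧_; not; if_then_else_)
open import Data.Bool.Properties
  using ( xor-assoc; xor-comm; xor-same; xor-identityʳ; not-involutive; not-distribˡ-xor
        ; ∧-zeroʳ; ∧-identityʳ; ∧-distribˡ-xor; ∧-distribʳ-xor; xor-∧-commutativeRing )
open import Data.Integer as ℤ using (ℤ; +_; -_; -[1+_]; _⊖_; ∣_∣; 1ℤ)
import Data.Integer.Properties as ℤ
open import Data.Integer.Divisibility using (_∣_)
open import Data.Integer.Divisibility.Signed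
  using (∣ᵤ⇒∣; ∣⇒∣ᵤ; ∣-refl; ∣-trans; ∣m∣n⇒∣m+n; ∣m∣n⇒∣m-n; ∣m+n∣n⇒∣m; ∣m⇒∣m*n; ∣n⇒∣m*n)
  renaming (_∣_ to _∣ˢ_; divides to dividesˢ)
import Data.Integer.Tactic.RingSolver as ℤ-Solver
open import Data.Nat as ℕ
  using ( ℕ; zero; suc; _+_; _*_; _∸_; _^_; _/_; _%_; _≤_; _<_; _≤′_; ≤′-refl; ≤′-step; z≤n; s≤s
        ; _≟_; _≤?_; _<?_; NonZero; >-nonZero; >-nonZero⁻¹ )
open import Data.Nat.Coprimality using (Coprime; coprime-Bézout)
open import Data.Nat.DivMod using (m≡m%n+[m/n]*n; m%n<n; m*n/n≡m)
import Data.Nat.Divisibility as ℕ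
open import Data.Nat.GCD using (module Bézout)
open import Data.Nat.Primality using (Prime; prime?; prime[2]; prime⇒irreducible; prime⇒nonZero; euclidsLemma)
open import Data.Nat.Properties
open import Data.Nat.Tactic.RingSolver using (solve-∀)
open import Data.Product using (_×_; ∃-syntax; _,_)
open import Data.Sum as Sum using (_⊎_; inj₁; inj₂; fromInj₂)
open import Function using (_∘_; const; id)
open import Function.Bundles using (_⇔_; mk⇔; Equivalence)
open import Relation.Binary.Bundles using (Setoid)
open import Relation.Binary.PropositionalEquality
open import Relation.Nullary using (¬_; yes; no; does; contradiction)
open import Relation.Nullary.Decidable using (dec-true; dec-false; does-⇔; from-yes)

open import Defs

open import Algebra.Properties.CommutativeSemigroup
  (CommutativeRing.+-commutativeSemigroup xor-∧-commutativeRing)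
  using () renaming (interchange to xor-interchange)
open Setoid (ℕ →-setoid Bool) using () renaming (trans to ≗-trans; sym to ≗-sym)

-- Power series over 𝔽₂

Series₂ : Set
Series₂ = ℕ → Bool

infixl 6 _⊕_
_⊕_ : Series₂ → Series₂ → Series₂
(a ⊕ b) n = a n xor b n

𝟙 : Series₂
𝟙 zero = true
𝟙 (suc _) = false

shift : ℕ → Series₂ → Series₂
shift zero a = a
shift (suc k) a zero = false
shift (suc k) a (suc n) = shift k a n

infixr 7 [1+q^_]·_
[1+q^_]·_ : ℕ → Series₂ → Series₂
[1+q^ k ]· a = a ⊕ shift k a

infix 4 _≗[≤_]_
_≗[≤_]_ : Series₂ → ℕ → Series₂ → Set
a ≗[≤ M ] b = ∀ n → n ≤ M → a n ≡ b n

≗[≤]-trans : ∀ {M a b c} → a ≗[≤ M ] b → b ≗[≤ M ] c → a ≗[≤ M ] c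
≗[≤]-trans a≗b b≗c n n≤M = trans (a≗b n n≤M) (b≗c n n≤M)

≗⇒≗[≤] : ∀ {M a b} → a ≗ b → a ≗[≤ M ] b
≗⇒≗[≤] a≗b n _ = a≗b n

shift-cong : ∀ k {a b} → a ≗ b → shift k a ≗ shift k b
shift-cong zero    a≗b n       = a≗b n
shift-cong (suc k) a≗b zero    = refl
shift-cong (suc k) a≗b (suc n) = shift-cong k a≗b n

shift-cong-≤ : ∀ k {M a b} → a ≗[≤ M ] b → shift k a ≗[≤ M ] shift k b
shift-cong-≤ zero    a≗b n       n≤M = a≗b n n≤M
shift-cong-≤ (suc k) a≗b zero    _   = refl
shift-cong-≤ (suc k) a≗b (suc n) n≤M = shift-cong-≤ k (λ m m≤M → a≗b m m≤M) n (≤-trans (n≤1+n n) n≤M)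

shift-⊕ : ∀ k a b → shift k (a ⊕ b) ≗ shift k a ⊕ shift k b
shift-⊕ zero    a b n       = refl
shift-⊕ (suc k) a b zero    = refl
shift-⊕ (suc k) a b (suc n) = shift-⊕ k a b n

shift-shift : ∀ j k a → shift j (shift k a) ≗ shift (j + k) a
shift-shift zero    k a n       = refl
shift-shift (suc j) k a zero    = refl
shift-shift (suc j) k a (suc n) = shift-shift j k a n

shift-≡ : ∀ {j k} a → j ≡ k → shift j a ≗ shift k a
shift-≡ a refl n = refl

shift-< : ∀ k a {n} → n < k → shift k a n ≡ false
shift-< (suc k) a {zero}  _         = refl
shift-< (suc k) a {suc n} (s≤s n<k) = shift-< k a n<k

shift-≥ : ∀ k a {n} → k ≤ n → shift k a n ≡ a (n ∸ k)
shift-≥ zero    a         _         = refl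
shift-≥ (suc k) a {suc n} (s≤s k≤n) = shift-≥ k a k≤n

shift-𝟙 : ∀ k n → shift k 𝟙 n ≡ does (n ≟ k)
shift-𝟙 zero    zero    = refl
shift-𝟙 zero    (suc n) = refl
shift-𝟙 (suc k) zero    = refl
shift-𝟙 (suc k) (suc n) = shift-𝟙 k n

[1+q^]-cong : ∀ k {a b} → a ≗ b → [1+q^ k ]· a ≗ [1+q^ k ]· b
[1+q^]-cong k a≗b n = cong₂ _xor_ (a≗b n) (shift-cong k a≗b n)

[1+q^]-cong-≤ : ∀ k {M a b} → a ≗[≤ M ] b → [1+q^ k ]· a ≗[≤ M ] [1+q^ k ]· b
[1+q^]-cong-≤ k a≗b n n≤M = cong₂ _xor_ (a≗b n n≤M) (shift-cong-≤ k a≗b n n≤M)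

[1+q^]-high : ∀ k {M} a → M < k → [1+q^ k ]· a ≗[≤ M ] a
[1+q^]-high k a M<k n n≤M =
  trans (cong (a n xor_) (shift-< k a (≤-<-trans n≤M M<k))) (xor-identityʳ (a n))

shift-[1+q^] : ∀ j k a → shift j ([1+q^ k ]· a) ≗ shift j a ⊕ shift (j + k) a
shift-[1+q^] j k a n = trans (shift-⊕ j a (shift k a) n) (cong (shift j a n xor_) (shift-shift j k a n))

[1+q^]-comm : ∀ j k a → [1+q^ j ]· [1+q^ k ]· a ≗ [1+q^ k ]· [1+q^ j ]· a
[1+q^]-comm j k a n = begin
  (a n xor shift k a n) xor shift j ([1+q^ k ]· a) n
    ≡⟨ cong ((a n xor shift k a n) xor_) (shift-[1+q^] j k a n) ⟩
  (a n xor shift k a n) xor (shift j a n xor shift (j + k) a n)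
    ≡⟨ xor-interchange (a n) _ _ _ ⟩
  (a n xor shift j a n) xor (shift k a n xor shift (j + k) a n)
    ≡⟨ cong (λ i → (a n xor shift j a n) xor (shift k a n xor shift i a n)) (+-comm j k) ⟩
  (a n xor shift j a n) xor (shift k a n xor shift (k + j) a n)
    ≡⟨ cong ((a n xor shift j a n) xor_) (shift-[1+q^] k j a n) ⟨
  (a n xor shift j a n) xor shift k ([1+q^ j ]· a) n ∎
  where open ≡-Reasoning

[1+q^]-square : ∀ k a → [1+q^ k ]· [1+q^ k ]· a ≗ [1+q^ (k + k) ]· a
[1+q^]-square k a n = begin
  (a n xor s) xor shift k ([1+q^ k ]· a) n
    ≡⟨ cong ((a n xor s) xor_) (shift-[1+q^] k k a n) ⟩
  (a n xor s) xor (s xor shift (k + k) a n)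
    ≡⟨ xor-assoc (a n) s _ ⟩
  a n xor (s xor (s xor shift (k + k) a n))
    ≡⟨ cong (a n xor_) (xor-assoc s s _) ⟨
  a n xor ((s xor s) xor shift (k + k) a n)
    ≡⟨ cong (λ z → a n xor (z xor shift (k + k) a n)) (xor-same s) ⟩
  a n xor shift (k + k) a n ∎
  where
  open ≡-Reasoning
  s = shift k a n

⨁ : ℕ → (ℕ → Bool) → Bool
⨁ zero    g = false
⨁ (suc n) g = ⨁ n g xor g n

syntax ⨁ n (λ i → b) = ⨁[ i < n ] b

⨁-cong : ∀ n {g h} → (∀ i → i < n → g i ≡ h i) → ⨁ n g ≡ ⨁ n h
⨁-cong zero    g≡h = refl
⨁-cong (suc n) g≡h = cong₂ _xor_ (⨁-cong n (λ i i<n → g≡h i (m≤n⇒m≤1+n i<n))) (g≡h n ≤-refl)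

⨁-xor : ∀ n g h → ⨁[ i < n ] (g i xor h i) ≡ ⨁ n g xor ⨁ n h
⨁-xor zero    g h = refl
⨁-xor (suc n) g h = trans (cong (_xor (g n xor h n)) (⨁-xor n g h)) (xor-interchange (⨁ n g) (⨁ n h) (g n) (h n))

∧-distribˡ-⨁ : ∀ n c g → c ∧ ⨁ n g ≡ ⨁[ i < n ] (c ∧ g i)
∧-distribˡ-⨁ zero    c g = ∧-zeroʳ c
∧-distribˡ-⨁ (suc n) c g = trans (∧-distribˡ-xor c (⨁ n g) (g n)) (cong (_xor (c ∧ g n)) (∧-distribˡ-⨁ n c g))

∧-distribʳ-⨁ : ∀ n c g → ⨁ n g ∧ c ≡ ⨁[ i < n ] (g i ∧ c)
∧-distribʳ-⨁ zero    c g = refl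
∧-distribʳ-⨁ (suc n) c g = trans (∧-distribʳ-xor c (⨁ n g) (g n)) (cong (_xor (g n ∧ c)) (∧-distribʳ-⨁ n c g))

⨁-false : ∀ n {g} → (∀ i → i < n → g i ≡ false) → ⨁ n g ≡ false
⨁-false zero    g≡0 = refl
⨁-false (suc n) g≡0 = cong₂ _xor_ (⨁-false n (λ i i<n → g≡0 i (m≤n⇒m≤1+n i<n))) (g≡0 n ≤-refl)

⨁-comm : ∀ m n (g : ℕ → ℕ → Bool) → ⨁[ i < m ] ⨁[ j < n ] g i j ≡ ⨁[ j < n ] ⨁[ i < m ] g i j
⨁-comm zero    n g = sym (⨁-false n (λ _ _ → refl))
⨁-comm (suc m) n g =
  trans (cong (_xor ⨁[ j < n ] g m j) (⨁-comm m n g)) (sym (⨁-xor n (λ j → ⨁[ i < m ] g i j) (g m)))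

⨁-+ : ∀ m n g → ⨁ (m + n) g ≡ ⨁ m g xor ⨁[ i < n ] g (m + i)
⨁-+ m zero    g rewrite +-identityʳ m = sym (xor-identityʳ (⨁ m g))
⨁-+ m (suc n) g rewrite +-suc m n = trans (cong (_xor g (m + n)) (⨁-+ m n g)) (xor-assoc (⨁ m g) _ _)

⨁-suc : ∀ n g → ⨁ (suc n) g ≡ g 0 xor ⨁[ i < n ] g (suc i)
⨁-suc n g = ⨁-+ 1 n g

⨁-single : ∀ n {g} a → a < n → (∀ i → i < n → i ≢ a → g i ≡ false) → ⨁ n g ≡ g a
⨁-single (suc n) {g} a a<1+n g≡0 with n ≟ a
... | yes refl = cong (_xor g n) (⨁-false n (λ i i<n → g≡0 i (m≤n⇒m≤1+n i<n) (<⇒≢ i<n)))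
... | no n≢a   = trans (cong₂ _xor_ (⨁-single n a a<n (λ i i<n → g≡0 i (m≤n⇒m≤1+n i<n))) (g≡0 n ≤-refl n≢a))
                       (xor-identityʳ (g a))
  where a<n = ≤∧≢⇒< (≤-pred a<1+n) (n≢a ∘ sym)

⨁-extend : ∀ m n {g} → (∀ i → m ≤ i → g i ≡ false) → m ≤ n → ⨁ n g ≡ ⨁ m g
⨁-extend m n {g} g≡0 m≤n = begin
  ⨁ n g                                 ≡⟨ cong (λ k → ⨁ k g) (m+[n∸m]≡n m≤n) ⟨
  ⨁ (m + (n ∸ m)) g                     ≡⟨ ⨁-+ m (n ∸ m) g ⟩
  ⨁ m g xor ⨁[ i < n ∸ m ] g (m + i)   ≡⟨ cong (⨁ m g xor_) (⨁-false (n ∸ m) (λ i _ → g≡0 (m + i) (m≤m+n m i))) ⟩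
  ⨁ m g xor false                       ≡⟨ xor-identityʳ (⨁ m g) ⟩
  ⨁ m g                                 ∎
  where open ≡-Reasoning

⨁-telescope : ∀ n (v : ℕ → Bool) → ⨁[ k < n ] (v k xor v (suc k)) ≡ v 0 xor v n
⨁-telescope zero    v = sym (xor-same (v 0))
⨁-telescope (suc n) v = begin
  ⨁[ k < n ] (v k xor v (suc k)) xor (v n xor v (suc n)) ≡⟨ cong (_xor (v n xor v (suc n))) (⨁-telescope n v) ⟩
  (v 0 xor v n) xor (v n xor v (suc n))                  ≡⟨ xor-assoc (v 0) (v n) _ ⟩
  v 0 xor (v n xor (v n xor v (suc n)))                  ≡⟨ cong (v 0 xor_) (xor-assoc (v n) (v n) _) ⟨
  v 0 xor ((v n xor v n) xor v (suc n))                  ≡⟨ cong (λ z → v 0 xor (z xor v (suc n))) (xor-same (v n)) ⟩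
  v 0 xor v (suc n)                                      ∎
  where open ≡-Reasoning

⨁-blocks : ∀ b K g → ⨁ (b * K) g ≡ ⨁[ j < K ] ⨁[ s < b ] g (b * j + s)
⨁-blocks b zero    g rewrite *-zeroʳ b = refl
⨁-blocks b (suc K) g = begin
  ⨁ (b * suc K) g                                  ≡⟨ cong (λ k → ⨁ k g) (trans (*-suc b K) (+-comm b (b * K))) ⟩
  ⨁ (b * K + b) g                                  ≡⟨ ⨁-+ (b * K) b g ⟩
  ⨁ (b * K) g xor ⨁[ s < b ] g (b * K + s)        ≡⟨ cong (_xor ⨁[ s < b ] g (b * K + s)) (⨁-blocks b K g) ⟩
  ⨁[ j < K ] ⨁[ s < b ] g (b * j + s) xor ⨁[ s < b ] g (b * K + s) ∎
  where open ≡-Reasoning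

⨁-multiples : ∀ b K g → .{{_ : NonZero b}} → (∀ j s → 0 < s → s < b → g (b * j + s) ≡ false) →
  ⨁ (b * K) g ≡ ⨁[ j < K ] g (b * j)
⨁-multiples (suc b) K g g≡0 = trans (⨁-blocks (suc b) K g) (⨁-cong K λ j _ → block j)
  where
  block : ∀ j → ⨁[ s < suc b ] g (suc b * j + s) ≡ g (suc b * j)
  block j = trans (⨁-single (suc b) 0 (s≤s z≤n) (λ { zero    _   0≢0 → contradiction refl 0≢0
                                                   ; (suc s) s<b _   → g≡0 j (suc s) (s≤s z≤n) s<b }))
                  (cong g (+-identityʳ (suc b * j)))

∏ : (ℕ → Bool) → (ℕ → ℕ) → ℕ → Series₂ → Series₂
∏ S e zero    a = a
∏ S e (suc N) a = if S (suc N) then [1+q^ e (suc N) ]· ∏ S e N a else ∏ S e N a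

∏-cong : ∀ S e N {a b} → a ≗ b → ∏ S e N a ≗ ∏ S e N b
∏-cong S e zero    a≗b = a≗b
∏-cong S e (suc N) a≗b with S (suc N)
... | true  = [1+q^]-cong (e (suc N)) (∏-cong S e N a≗b)
... | false = ∏-cong S e N a≗b

∏-cong-≤ : ∀ S e N {M a b} → a ≗[≤ M ] b → ∏ S e N a ≗[≤ M ] ∏ S e N b
∏-cong-≤ S e zero    a≗b = a≗b
∏-cong-≤ S e (suc N) a≗b with S (suc N)
... | true  = [1+q^]-cong-≤ (e (suc N)) (∏-cong-≤ S e N a≗b)
... | false = ∏-cong-≤ S e N a≗b

∏-cong-exp : ∀ S {e e'} N a → e ≗ e' → ∏ S e N a ≗ ∏ S e' N a
∏-cong-exp S zero    a e≗e' = λ _ → refl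
∏-cong-exp S {e} {e'} (suc N) a e≗e' with S (suc N)
... | true  = ≗-trans ([1+q^]-cong (e (suc N)) (∏-cong-exp S N a e≗e'))
                      (λ n → cong (λ k → ([1+q^ k ]· ∏ S e' N a) n) (e≗e' (suc N)))
... | false = ∏-cong-exp S N a e≗e'

∏-cong-sel : ∀ {S S'} e N a → (∀ i → S (suc i) ≡ S' (suc i)) → ∏ S e N a ≗ ∏ S' e N a
∏-cong-sel         e zero    a S≡S' = λ _ → refl
∏-cong-sel {S} {S'} e (suc N) a S≡S' with S (suc N) | S' (suc N) | S≡S' N
... | true  | true  | _ = [1+q^]-cong (e (suc N)) (∏-cong-sel e N a S≡S')
... | false | false | _ = ∏-cong-sel e N a S≡S'

∏-[1+q^] : ∀ S e N k a → ∏ S e N ([1+q^ k ]· a) ≗ [1+q^ k ]· ∏ S e N a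
∏-[1+q^] S e zero    k a = λ _ → refl
∏-[1+q^] S e (suc N) k a with S (suc N)
... | true  = ≗-trans ([1+q^]-cong (e (suc N)) (∏-[1+q^] S e N k a)) ([1+q^]-comm (e (suc N)) k (∏ S e N a))
... | false = ∏-[1+q^] S e N k a

∏-split : ∀ S e N a → ∏ S e N (∏ (not ∘ S) e N a) ≗ ∏ (const true) e N a
∏-split S e zero    a = λ _ → refl
∏-split S e (suc N) a with S (suc N)
... | true  = [1+q^]-cong (e (suc N)) (∏-split S e N a)
... | false = ≗-trans (∏-[1+q^] S e N (e (suc N)) (∏ (not ∘ S) e N a)) ([1+q^]-cong (e (suc N)) (∏-split S e N a))

∏-square : ∀ S e N a → ∏ S e N (∏ S e N a) ≗ ∏ S (λ i → e i + e i) N a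
∏-square S e zero    a = λ _ → refl
∏-square S e (suc N) a with S (suc N)
... | true  = ≗-trans ([1+q^]-cong (e (suc N)) (∏-[1+q^] S e N (e (suc N)) (∏ S e N a)))
             (≗-trans ([1+q^]-square (e (suc N)) (∏ S e N (∏ S e N a))) ([1+q^]-cong (e (suc N) + e (suc N)) (∏-square S e N a)))
... | false = ∏-square S e N a

∏-high : ∀ S e {N N' M} a → N ≤ N' → (∀ i → N < i → i ≤ N' → M < e i) → ∏ S e N' a ≗[≤ M ] ∏ S e N a
∏-high S e a N≤N' = go (≤⇒≤′ N≤N')
  where
  go : ∀ {N N' M} → N ≤′ N' → (∀ i → N < i → i ≤ N' → M < e i) → ∏ S e N' a ≗[≤ M ] ∏ S e N a
  go ≤′-refl _ _ _ = refl
  go {N' = suc N'} (≤′-step N≤N') high with S (suc N')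
  ... | true  = ≗[≤]-trans ([1+q^]-high (e (suc N')) _ (high (suc N') (s≤s (≤′⇒≤ N≤N')) ≤-refl))
                           (go N≤N' (λ i N<i i≤N' → high i N<i (m≤n⇒m≤1+n i≤N')))
  ... | false = go N≤N' (λ i N<i i≤N' → high i N<i (m≤n⇒m≤1+n i≤N'))

∏-skip : ∀ S e {N N'} a → N ≤ N' → (∀ i → N < i → i ≤ N' → S i ≡ false) → ∏ S e N' a ≗ ∏ S e N a
∏-skip S e a N≤N' = go (≤⇒≤′ N≤N')
  where
  go : ∀ {N N'} → N ≤′ N' → (∀ i → N < i → i ≤ N' → S i ≡ false) → ∏ S e N' a ≗ ∏ S e N a
  go ≤′-refl _ _ = refl
  go {N' = suc N'} (≤′-step N≤N') skip with S (suc N') | skip (suc N') (s≤s (≤′⇒≤ N≤N')) ≤-refl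
  ... | false | _ = go N≤N' (λ i N<i i≤N' → skip i N<i (m≤n⇒m≤1+n i≤N'))

∏-multiples : ∀ b {T S} e a .{{_ : NonZero b}} →
  (∀ j s → 0 < s → s < b → T (b * j + s) ≡ false) → (∀ j → T (b * j) ≡ S j) →
  ∀ L → ∏ T e (b * L) a ≗ ∏ S (e ∘ (b *_)) L a
∏-multiples (suc c) {T} {S} e a off on zero rewrite *-zeroʳ c = λ _ → refl
∏-multiples b@(suc c) {T} {S} e a off on (suc L) = step below
  where
  K = L + c * suc L
  K≡bL+c : K ≡ b * L + c
  K≡bL+c = identity L c
    where
    identity : ∀ L c → L + c * suc L ≡ suc c * L + c
    identity = solve-∀
  below : ∏ T e K a ≗ ∏ S (e ∘ (b *_)) L a
  below = ≗-trans (subst (λ k → ∏ T e k a ≗ ∏ T e (b * L) a) (sym K≡bL+c) (∏-skip T e a (m≤m+n (b * L) c) skipped))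
                  (∏-multiples b e a off on L)
    where
    skipped : ∀ i → b * L < i → i ≤ b * L + c → T i ≡ false
    skipped i bL<i i≤bL+c = subst (λ k → T k ≡ false) (m+[n∸m]≡n (<⇒≤ bL<i))
      (off L (i ∸ b * L) (m<n⇒0<n∸m bL<i)
           (s≤s (subst (i ∸ b * L ≤_) (m+n∸m≡n (b * L) c) (∸-monoˡ-≤ (b * L) i≤bL+c))))
  step : ∏ T e K a ≗ ∏ S (e ∘ (b *_)) L a → ∏ T e (suc K) a ≗ ∏ S (e ∘ (b *_)) (suc L) a
  step h with T (suc K) | S (suc L) | on (suc L)
  ... | true  | true  | _ = [1+q^]-cong (e (suc K)) h
  ... | false | false | _ = h

infixl 7 _∗_
_∗_ : Series₂ → Series₂ → Series₂
(a ∗ b) n = ⨁[ i < suc n ] (a i ∧ b (n ∸ i))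

∗-cong-≤ : ∀ {M a a' b b'} → a ≗[≤ M ] a' → b ≗[≤ M ] b' → a ∗ b ≗[≤ M ] a' ∗ b'
∗-cong-≤ a≗a' b≗b' n n≤M = ⨁-cong (suc n) λ i i≤n →
  cong₂ _∧_ (a≗a' i (≤-trans (≤-pred i≤n) n≤M)) (b≗b' (n ∸ i) (≤-trans (m∸n≤m n i) n≤M))

∗-cong : ∀ {a a' b b'} → a ≗ a' → b ≗ b' → a ∗ b ≗ a' ∗ b'
∗-cong a≗a' b≗b' n = ∗-cong-≤ (≗⇒≗[≤] a≗a') (≗⇒≗[≤] b≗b') n ≤-refl

⊕-∗ : ∀ a a' b → (a ⊕ a') ∗ b ≗ a ∗ b ⊕ a' ∗ b
⊕-∗ a a' b n = trans (⨁-cong (suc n) (λ i _ → ∧-distribʳ-xor (b (n ∸ i)) (a i) (a' i)))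
                     (⨁-xor (suc n) (λ i → a i ∧ b (n ∸ i)) (λ i → a' i ∧ b (n ∸ i)))

∗-⊕ : ∀ a b b' → a ∗ (b ⊕ b') ≗ a ∗ b ⊕ a ∗ b'
∗-⊕ a b b' n = trans (⨁-cong (suc n) (λ i _ → ∧-distribˡ-xor (a i) (b (n ∸ i)) (b' (n ∸ i))))
                     (⨁-xor (suc n) (λ i → a i ∧ b (n ∸ i)) (λ i → a i ∧ b' (n ∸ i)))

shift-∗ : ∀ k a b → shift k a ∗ b ≗ shift k (a ∗ b)
shift-∗ zero    a b n       = refl
shift-∗ (suc k) a b zero    = refl
shift-∗ (suc k) a b (suc n) = trans (⨁-suc (suc n) (λ i → shift (suc k) a i ∧ b (suc n ∸ i))) (shift-∗ k a b n)

[1+q^]-∗ : ∀ k a b → ([1+q^ k ]· a) ∗ b ≗ [1+q^ k ]· (a ∗ b)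
[1+q^]-∗ k a b n = trans (⊕-∗ a (shift k a) b n) (cong ((a ∗ b) n xor_) (shift-∗ k a b n))

𝟙-∗ : ∀ b → 𝟙 ∗ b ≗ b
𝟙-∗ b n = trans (⨁-suc n (λ i → 𝟙 i ∧ b (n ∸ i)))
                 (trans (cong (b n xor_) (⨁-false n (λ _ _ → refl))) (xor-identityʳ (b n)))

∗-monomial : ∀ d a → a ∗ shift d 𝟙 ≗ shift d a
∗-monomial d a n with d ≤? n
... | yes d≤n = begin
  ⨁[ i < suc n ] (a i ∧ shift d 𝟙 (n ∸ i))   ≡⟨ ⨁-single (suc n) (n ∸ d) (s≤s (m∸n≤m n d)) off ⟩
  a (n ∸ d) ∧ shift d 𝟙 (n ∸ (n ∸ d))        ≡⟨ cong (λ m → a (n ∸ d) ∧ shift d 𝟙 m) (m∸[m∸n]≡n d≤n) ⟩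
  a (n ∸ d) ∧ shift d 𝟙 d                     ≡⟨ cong (a (n ∸ d) ∧_) (trans (shift-𝟙 d d) (dec-true (d ≟ d) refl)) ⟩
  a (n ∸ d) ∧ true                            ≡⟨ ∧-identityʳ (a (n ∸ d)) ⟩
  a (n ∸ d)                                   ≡⟨ shift-≥ d a d≤n ⟨
  shift d a n                                 ∎
  where
  open ≡-Reasoning
  off : ∀ i → i < suc n → i ≢ n ∸ d → a i ∧ shift d 𝟙 (n ∸ i) ≡ false
  off i i≤n i≢n-d = trans (cong (a i ∧_) (trans (shift-𝟙 d (n ∸ i)) (dec-false (n ∸ i ≟ d) n-i≢d))) (∧-zeroʳ (a i))
    where
    n-i≢d : n ∸ i ≢ d
    n-i≢d n-i≡d = i≢n-d (trans (sym (m∸[m∸n]≡n (≤-pred i≤n))) (cong (n ∸_) n-i≡d))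
... | no d≰n = trans (⨁-false (suc n) off) (sym (shift-< d a (≰⇒> d≰n)))
  where
  off : ∀ i → i < suc n → a i ∧ shift d 𝟙 (n ∸ i) ≡ false
  off i _ = trans (cong (a i ∧_) (shift-< d 𝟙 (≤-<-trans (m∸n≤m n i) (≰⇒> d≰n)))) (∧-zeroʳ (a i))

∗-[1+q^] : ∀ d a → a ∗ (𝟙 ⊕ shift d 𝟙) ≗ [1+q^ d ]· a
∗-[1+q^] d a n = trans (∗-⊕ a 𝟙 (shift d 𝟙) n) (cong₂ _xor_ (∗-monomial 0 a n) (∗-monomial d a n))

∏-∗ : ∀ S e N a b → ∏ S e N a ∗ b ≗ ∏ S e N (a ∗ b)
∏-∗ S e zero    a b = λ _ → refl
∏-∗ S e (suc N) a b with S (suc N)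
... | true  = ≗-trans ([1+q^]-∗ (e (suc N)) (∏ S e N a) b) ([1+q^]-cong (e (suc N)) (∏-∗ S e N a b))
... | false = ∏-∗ S e N a b

-- Euler's pentagonal theorem modulo 2

triangular : ℕ → ℕ
triangular zero    = 0
triangular (suc k) = triangular k + suc k

-- j(3j + 1)/2 and (j + 1)(3j + 2)/2, i.e. (x² − 1)/24 for x = 6j + 1 and x = 6j + 5.
pentagonal⁺ pentagonal⁻ : ℕ → ℕ
pentagonal⁺ j = j * j + triangular j
pentagonal⁻ j = j * suc j + triangular (suc j)

tailProduct : ℕ → ℕ → ℕ → Series₂
tailProduct d k n = ∏ (λ i → does (k <? i)) (d *_) n 𝟙

tailProduct-empty : ∀ d {k n} → n ≤ k → tailProduct d k n ≗ 𝟙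
tailProduct-empty d {k} n≤k = ∏-skip _ (d *_) 𝟙 z≤n (λ i _ i≤n → dec-false (k <? i) (≤⇒≯ (≤-trans i≤n n≤k)))

tailProduct-suc : ∀ d {k n} → k ≤ n → tailProduct d k (suc n) ≡ [1+q^ d * suc n ]· tailProduct d k n
tailProduct-suc d {k} {n} k≤n rewrite dec-true (k <? suc n) (s≤s k≤n) = refl

tailProduct-lower : ∀ d {k n} → k < n → tailProduct d k n ≗ [1+q^ d * suc k ]· tailProduct d (suc k) n
tailProduct-lower d {k} {suc n} (s≤s k≤n) with m≤n⇒m<n∨m≡n k≤n
... | inj₁ k<n rewrite tailProduct-suc d k≤n | tailProduct-suc d k<n =
  ≗-trans ([1+q^]-cong (d * suc n) (tailProduct-lower d k<n)) ([1+q^]-comm (d * suc n) (d * suc k) (tailProduct d (suc k) n))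
... | inj₂ refl rewrite tailProduct-suc d k≤n =
  ≗-trans ([1+q^]-cong (d * suc k) (tailProduct-empty d {k} ≤-refl))
          ([1+q^]-cong (d * suc k) (≗-sym (tailProduct-empty d {suc k} ≤-refl)))

-- Shanks' proof of the pentagonal theorem: from n to n + 1 each shanksTerm changes by two correction terms,
-- which telescope in the sum over k.
shanksTerm : ℕ → ℕ → ℕ → Series₂
shanksTerm d n k = shift (d * (n * k + triangular k)) (tailProduct d k n)

shanksCorrection : ℕ → ℕ → ℕ → Series₂
shanksCorrection d n zero    = const false
shanksCorrection d n (suc k) = shift (d * (n * suc k + triangular (suc k))) (tailProduct d k n)

private
  xor-cancel-middle : ∀ a b c → a xor ((a xor b) xor c) ≡ b xor c
  xor-cancel-middle a b c = begin
    a xor ((a xor b) xor c)   ≡⟨ xor-assoc a (a xor b) c ⟨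
    (a xor (a xor b)) xor c   ≡⟨ cong (_xor c) (xor-assoc a a b) ⟨
    ((a xor a) xor b) xor c   ≡⟨ cong (λ z → (z xor b) xor c) (xor-same a) ⟩
    b xor c                   ∎
    where open ≡-Reasoning

shanksTerm-suc : ∀ d {n} k → k ≤ n →
  shanksTerm d (suc n) k ≗ shanksTerm d n k ⊕ (shanksCorrection d n k ⊕ shanksCorrection d n (suc k))
shanksTerm-suc d {n} zero _ m = begin
  shift (d * (suc n * 0 + 0)) (tailProduct d 0 (suc n)) m
    ≡⟨ shift-≡ _ (exponent₀ d n) m ⟩
  tailProduct d 0 (suc n) m
    ≡⟨ cong (λ a → a m) (tailProduct-suc d {n = n} z≤n) ⟩
  X m xor shift (d * suc n) X m
    ≡⟨ cong₂ _xor_ (shift-≡ X (exponent₀′ d n) m) (shift-≡ X (exponent₁ d n) m) ⟨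
  shanksTerm d n 0 m xor shanksCorrection d n 1 m ∎
  where
  open ≡-Reasoning
  X = tailProduct d 0 n
  exponent₀ : ∀ d n → d * (suc n * 0 + 0) ≡ 0
  exponent₀ = solve-∀
  exponent₀′ : ∀ d n → d * (n * 0 + 0) ≡ 0
  exponent₀′ = solve-∀
  exponent₁ : ∀ d n → d * (n * 1 + (0 + 1)) ≡ d * suc n
  exponent₁ = solve-∀
shanksTerm-suc d {n} (suc k) k<n m = begin
  shift (d * (suc n * suc k + triangular (suc k))) (tailProduct d (suc k) (suc n)) m
    ≡⟨ shift-≡ _ (exponentˡ d n k (triangular k)) m ⟩
  shift (E + F) (tailProduct d (suc k) (suc n)) m
    ≡⟨ cong (λ a → shift (E + F) a m) (tailProduct-suc d k<n) ⟩
  shift (E + F) ([1+q^ G ]· X) m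
    ≡⟨ shift-[1+q^] (E + F) G X m ⟩
  shift (E + F) X m xor shift (E + F + G) X m
    ≡⟨ xor-cancel-middle (shift E X m) _ _ ⟨
  shift E X m xor ((shift E X m xor shift (E + F) X m) xor shift (E + F + G) X m)
    ≡⟨ cong (λ z → shift E X m xor (z xor shift (E + F + G) X m))
            (trans (shift-cong E (tailProduct-lower d k<n) m) (shift-[1+q^] E F X m)) ⟨
  shift E X m xor (shanksCorrection d n (suc k) m xor shift (E + F + G) X m)
    ≡⟨ cong (λ z → shift E X m xor (shanksCorrection d n (suc k) m xor z)) (shift-≡ X (exponentʳ d n k (triangular k)) m) ⟨
  shanksTerm d n (suc k) m xor (shanksCorrection d n (suc k) m xor shanksCorrection d n (suc (suc k)) m) ∎
  where
  open ≡-Reasoning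
  X = tailProduct d (suc k) n
  E = d * (n * suc k + triangular (suc k))
  F = d * suc k
  G = d * suc n
  exponentˡ : ∀ d n k t → d * (suc n * suc k + (t + suc k)) ≡ d * (n * suc k + (t + suc k)) + d * suc k
  exponentˡ = solve-∀
  exponentʳ : ∀ d n k t →
    d * (n * suc (suc k) + ((t + suc k) + suc (suc k))) ≡ d * (n * suc k + (t + suc k)) + d * suc k + d * suc n
  exponentʳ = solve-∀

shanksSum : ℕ → ℕ → Series₂
shanksSum d n m = ⨁[ k < suc n ] shanksTerm d n k m

pentagonalPartial : ℕ → ℕ → Series₂
pentagonalPartial d n m =
  𝟙 m xor ⨁[ j < n ] (shift (d * pentagonal⁻ j) 𝟙 m xor shift (d * pentagonal⁺ (suc j)) 𝟙 m)

shanks : ∀ d n → shanksSum d n ≗ pentagonalPartial d n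
shanks d zero    m = trans (shift-≡ _ (*-zeroʳ d) m) (sym (xor-identityʳ (𝟙 m)))
shanks d (suc n) m = begin
  ⨁[ k < suc n ] shanksTerm d (suc n) k m xor last
    ≡⟨ cong (_xor last) (⨁-cong (suc n) (λ k k≤n → shanksTerm-suc d k (≤-pred k≤n) m)) ⟩
  ⨁[ k < suc n ] (shanksTerm d n k m xor (v k xor v (suc k))) xor last
    ≡⟨ cong (_xor last) (⨁-xor (suc n) (λ k → shanksTerm d n k m) (λ k → v k xor v (suc k))) ⟩
  (shanksSum d n m xor ⨁[ k < suc n ] (v k xor v (suc k))) xor last
    ≡⟨ cong (λ z → (shanksSum d n m xor z) xor last) (⨁-telescope (suc n) v) ⟩
  (shanksSum d n m xor v (suc n)) xor last
    ≡⟨ xor-assoc (shanksSum d n m) (v (suc n)) last ⟩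
  shanksSum d n m xor (v (suc n) xor last)
    ≡⟨ cong₂ (λ a b → a xor (b xor last)) (shanks d n m)
             (shift-cong (d * pentagonal⁻ n) (tailProduct-empty d {n} ≤-refl) m) ⟩
  pentagonalPartial d n m xor (shift (d * pentagonal⁻ n) 𝟙 m xor last)
    ≡⟨ cong (λ b → pentagonalPartial d n m xor (shift (d * pentagonal⁻ n) 𝟙 m xor b))
            (shift-cong (d * pentagonal⁺ (suc n)) (tailProduct-empty d {suc n} ≤-refl) m) ⟩
  pentagonalPartial d n m xor (shift (d * pentagonal⁻ n) 𝟙 m xor shift (d * pentagonal⁺ (suc n)) 𝟙 m)
    ≡⟨ xor-assoc (𝟙 m) _ _ ⟩
  pentagonalPartial d (suc n) m ∎
  where
  open ≡-Reasoning
  v : ℕ → Bool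
  v k = shanksCorrection d n k m
  last : Bool
  last = shanksTerm d (suc n) (suc n) m

shanksTerm-vanishes : ∀ d .{{_ : NonZero d}} n k {r} → r ≤ n → shanksTerm d n (suc k) r ≡ false
shanksTerm-vanishes d n k {r} r≤n = shift-< _ (tailProduct d (suc k) n) (begin-strict
  r                                    ≤⟨ r≤n ⟩
  n                                    <⟨ n<1+n n ⟩
  suc n                                ≡⟨ +-comm 1 n ⟩
  n + 1                                ≤⟨ +-mono-≤ (m≤m*n n (suc k)) (≤-trans (s≤s z≤n) (m≤n+m _ (triangular k))) ⟩
  n * suc k + triangular (suc k)       ≤⟨ m≤n*m _ d ⟩
  d * (n * suc k + triangular (suc k)) ∎)
  where open ≤-Reasoning

eulerProduct : ℕ → ℕ → Series₂
eulerProduct d N = ∏ (const true) (d *_) N 𝟙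

euler-pentagonal : ∀ d .{{_ : NonZero d}} n → eulerProduct d n ≗[≤ n ] pentagonalPartial d n
euler-pentagonal d n r r≤n = begin
  eulerProduct d n r
    ≡⟨ ∏-cong-sel (d *_) n 𝟙 (λ _ → refl) r ⟩
  tailProduct d 0 n r
    ≡⟨ shift-≡ (tailProduct d 0 n) (exponent₀ d n) r ⟨
  shanksTerm d n 0 r
    ≡⟨ xor-identityʳ _ ⟨
  shanksTerm d n 0 r xor false
    ≡⟨ cong (shanksTerm d n 0 r xor_) (⨁-false n (λ k _ → shanksTerm-vanishes d n k r≤n)) ⟨
  shanksTerm d n 0 r xor ⨁[ k < n ] shanksTerm d n (suc k) r
    ≡⟨ ⨁-suc n (λ k → shanksTerm d n k r) ⟨
  shanksSum d n r
    ≡⟨ shanks d n r ⟩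
  pentagonalPartial d n r ∎
  where
  open ≡-Reasoning
  exponent₀ : ∀ d n → d * (n * 0 + 0) ≡ 0
  exponent₀ = solve-∀

coprime6 : ℕ → Bool
coprime6 x = not (does (2 ℕ.∣? x)) ∧ not (does (3 ℕ.∣? x))

coprime6-periodic : ∀ j s → coprime6 (6 * j + s) ≡ coprime6 s
coprime6-periodic j s =
  cong₂ (λ a b → not a ∧ not b) (divides-ignore 2 (ℕ.divides 3 refl)) (divides-ignore 3 (ℕ.divides 2 refl))
  where
  divides-ignore : ∀ d → d ℕ.∣ 6 → does (d ℕ.∣? 6 * j + s) ≡ does (d ℕ.∣? s)
  divides-ignore d d∣6 = does-⇔ (mk⇔ (λ d∣6j+s → ℕ.∣m+n∣m⇒∣n d∣6j+s d∣6j) (ℕ.∣m∣n⇒∣m+n d∣6j))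
                                (d ℕ.∣? 6 * j + s) (d ℕ.∣? s)
    where d∣6j = ℕ.∣m⇒∣m*n j d∣6

triangular-double : ∀ j → 2 * triangular j ≡ j * suc j
triangular-double zero    = refl
triangular-double (suc j) = begin
  2 * (triangular j + suc j)      ≡⟨ *-distribˡ-+ 2 (triangular j) (suc j) ⟩
  2 * triangular j + 2 * suc j    ≡⟨ cong (_+ 2 * suc j) (triangular-double j) ⟩
  j * suc j + 2 * suc j           ≡⟨ identity j ⟩
  suc j * suc (suc j)             ∎
  where
  open ≡-Reasoning
  identity : ∀ j → j * suc j + 2 * suc j ≡ suc j * suc (suc j)
  identity = solve-∀

square-6j+1 : ∀ j → (6 * j + 1) * (6 * j + 1) ≡ 24 * pentagonal⁺ j + 1
square-6j+1 j = begin
  (6 * j + 1) * (6 * j + 1)              ≡⟨ expand j ⟩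
  24 * (j * j) + 12 * (j * suc j) + 1    ≡⟨ cong (λ t → 24 * (j * j) + 12 * t + 1) (triangular-double j) ⟨
  24 * (j * j) + 12 * (2 * T) + 1        ≡⟨ collect (j * j) T ⟩
  24 * pentagonal⁺ j + 1                 ∎
  where
  open ≡-Reasoning
  T = triangular j
  expand : ∀ j → (6 * j + 1) * (6 * j + 1) ≡ 24 * (j * j) + 12 * (j * suc j) + 1
  expand = solve-∀
  collect : ∀ s t → 24 * s + 12 * (2 * t) + 1 ≡ 24 * (s + t) + 1
  collect = solve-∀

square-6j+5 : ∀ j → (6 * j + 5) * (6 * j + 5) ≡ 24 * pentagonal⁻ j + 1
square-6j+5 j = begin
  (6 * j + 5) * (6 * j + 5)
    ≡⟨ expand j ⟩
  24 * (j * suc j) + 12 * (suc j * suc (suc j)) + 1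
    ≡⟨ cong (λ t → 24 * (j * suc j) + 12 * t + 1) (triangular-double (suc j)) ⟨
  24 * (j * suc j) + 12 * (2 * T) + 1
    ≡⟨ collect (j * suc j) T ⟩
  24 * pentagonal⁻ j + 1 ∎
  where
  open ≡-Reasoning
  T = triangular (suc j)
  expand : ∀ j → (6 * j + 5) * (6 * j + 5) ≡ 24 * (j * suc j) + 12 * (suc j * suc (suc j)) + 1
  expand = solve-∀
  collect : ∀ s t → 24 * s + 12 * (2 * t) + 1 ≡ 24 * (s + t) + 1
  collect = solve-∀

coprime6-square : ∀ x → coprime6 x ≡ true → ∃[ a ] x * x ≡ 24 * a + 1
coprime6-square x cop = subst (λ y → ∃[ a ] y * y ≡ 24 * a + 1) (sym x≡6q+r)
  (square (x / 6) (residue (x % 6) (m%n<n x 6) coprime6-r))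
  where
  x≡6q+r : x ≡ 6 * (x / 6) + x % 6
  x≡6q+r = trans (m≡m%n+[m/n]*n x 6) (trans (+-comm (x % 6) _) (cong (_+ x % 6) (*-comm (x / 6) 6)))
  coprime6-r : coprime6 (x % 6) ≡ true
  coprime6-r = trans (sym (coprime6-periodic (x / 6) (x % 6))) (trans (cong coprime6 (sym x≡6q+r)) cop)
  residue : ∀ r → r < 6 → coprime6 r ≡ true → r ≡ 1 ⊎ r ≡ 5
  residue 1 _ _ = inj₁ refl
  residue 5 _ _ = inj₂ refl
  residue 0 _ ()
  residue 2 _ ()
  residue 3 _ ()
  residue 4 _ ()
  residue (suc (suc (suc (suc (suc (suc r)))))) (s≤s (s≤s (s≤s (s≤s (s≤s (s≤s ())))))) _
  square : ∀ q {r} → r ≡ 1 ⊎ r ≡ 5 → ∃[ a ] (6 * q + r) * (6 * q + r) ≡ 24 * a + 1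
  square q (inj₁ refl) = pentagonal⁺ q , square-6j+1 q
  square q (inj₂ refl) = pentagonal⁻ q , square-6j+5 q

≟-affine : ∀ c .{{_ : NonZero c}} d r s → does (c * r + d ≟ c * s + d) ≡ does (r ≟ s)
≟-affine c d r s = does-⇔ (mk⇔ (λ eq → *-cancelˡ-≡ r s c (+-cancelʳ-≡ d (c * r) (c * s) eq)) (cong (λ t → c * t + d)))
                          (c * r + d ≟ c * s + d) (r ≟ s)

unitSquareSeries : ℕ → ℕ → Series₂
unitSquareSeries d B r = ⨁[ x < B ] (coprime6 x ∧ does (24 * r + d ≟ d * (x * x)))

square-indicator : ∀ d r {x a} → x * x ≡ 24 * a + 1 → does (24 * r + d ≟ d * (x * x)) ≡ does (r ≟ d * a)
square-indicator d r {x} {a} x²≡24a+1 =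
  trans (cong (λ t → does (24 * r + d ≟ t)) (trans (cong (d *_) x²≡24a+1) (identity d a))) (≟-affine 24 d r (d * a))
  where
  identity : ∀ d a → d * (24 * a + 1) ≡ 24 * (d * a) + d
  identity = solve-∀

unitSquares-block : ∀ d r j →
  ⨁[ s < 6 ] (coprime6 (6 * j + s) ∧ does (24 * r + d ≟ d * ((6 * j + s) * (6 * j + s))))
    ≡ does (r ≟ d * pentagonal⁺ j) xor does (r ≟ d * pentagonal⁻ j)
unitSquares-block d r j = begin
  ⨁[ s < 6 ] (coprime6 (6 * j + s) ∧ F s)
    ≡⟨ ⨁-cong 6 (λ s _ → cong (_∧ F s) (coprime6-periodic j s)) ⟩
  (((F 1 xor false) xor false) xor false) xor F 5
    ≡⟨ collapse (F 1) (F 5) ⟩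
  F 1 xor F 5
    ≡⟨ cong₂ _xor_ (square-indicator d r {6 * j + 1} (square-6j+1 j)) (square-indicator d r {6 * j + 5} (square-6j+5 j)) ⟩
  does (r ≟ d * pentagonal⁺ j) xor does (r ≟ d * pentagonal⁻ j) ∎
  where
  open ≡-Reasoning
  F : ℕ → Bool
  F s = does (24 * r + d ≟ d * ((6 * j + s) * (6 * j + s)))
  collapse : ∀ a b → (((a xor false) xor false) xor false) xor b ≡ a xor b
  collapse true  b = refl
  collapse false b = refl

pentagonal-unitSquares : ∀ d .{{_ : NonZero d}} n {r} → r ≤ n → pentagonalPartial d n r ≡ unitSquareSeries d (6 * suc n) r
pentagonal-unitSquares d n {r} r≤n = sym (begin
  unitSquareSeries d (6 * suc n) r
    ≡⟨ ⨁-blocks 6 (suc n) F ⟩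
  ⨁[ j < suc n ] ⨁[ s < 6 ] F (6 * j + s)
    ≡⟨ ⨁-cong (suc n) (λ j _ → unitSquares-block d r j) ⟩
  ⨁[ j < suc n ] (A j xor B j)
    ≡⟨ ⨁-xor (suc n) A B ⟩
  ⨁ (suc n) A xor (⨁ n B xor B n)
    ≡⟨ cong₂ (λ a b → a xor (⨁ n B xor b)) (⨁-suc n A) Bn≡false ⟩
  (A 0 xor ⨁[ j < n ] A (suc j)) xor (⨁ n B xor false)
    ≡⟨ rearrange (A 0) (⨁[ j < n ] A (suc j)) (⨁ n B) ⟩
  A 0 xor (⨁ n B xor ⨁[ j < n ] A (suc j))
    ≡⟨ cong₂ _xor_ A0≡𝟙 (⨁-xor n B (A ∘ suc)) ⟨
  𝟙 r xor ⨁[ j < n ] (B j xor A (suc j))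
    ≡⟨ cong (𝟙 r xor_) (⨁-cong n (λ j _ → cong₂ _xor_ (shift-𝟙 _ r) (shift-𝟙 _ r))) ⟨
  pentagonalPartial d n r ∎)
  where
  open ≡-Reasoning
  F : ℕ → Bool
  F x = coprime6 x ∧ does (24 * r + d ≟ d * (x * x))
  A B : ℕ → Bool
  A j = does (r ≟ d * pentagonal⁺ j)
  B j = does (r ≟ d * pentagonal⁻ j)
  Bn≡false : B n ≡ false
  Bn≡false = dec-false (r ≟ d * pentagonal⁻ n) (<⇒≢ (<-≤-trans (s≤s r≤n) (≤-trans n<pentagonal⁻ (m≤n*m _ d))))
    where
    n<pentagonal⁻ : suc n ≤ pentagonal⁻ n
    n<pentagonal⁻ = ≤-trans (m≤n+m (suc n) (triangular n)) (m≤n+m _ (n * suc n))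
  rearrange : ∀ a s t → (a xor s) xor (t xor false) ≡ a xor (t xor s)
  rearrange a s t = trans (cong ((a xor s) xor_) (xor-identityʳ t)) (trans (xor-assoc a s t) (cong (a xor_) (xor-comm s t)))
  A0≡𝟙 : 𝟙 r ≡ A 0
  A0≡𝟙 = trans (shift-𝟙 0 r) (cong (λ t → does (r ≟ t)) (sym (*-zeroʳ d)))

eulerProduct-unitSquares : ∀ d .{{_ : NonZero d}} {n N} → n ≤ N → eulerProduct d n ≗[≤ n ] unitSquareSeries d (6 * suc N)
eulerProduct-unitSquares d {n} {N} n≤N r r≤n = begin
  eulerProduct d n r
    ≡⟨ ∏-high (const true) (d *_) 𝟙 n≤N (λ i n<i _ → <-≤-trans n<i (m≤n*m i d)) r r≤n ⟨
  eulerProduct d N r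
    ≡⟨ euler-pentagonal d N r r≤N ⟩
  pentagonalPartial d N r
    ≡⟨ pentagonal-unitSquares d N r≤N ⟩
  unitSquareSeries d (6 * suc N) r ∎
  where
  open ≡-Reasoning
  r≤N = ≤-trans r≤n n≤N

-- The generating function of Q modulo 2

odd : ℕ → Bool
odd zero    = false
odd (suc n) = not (odd n)

odd-+ : ∀ m n → odd (m + n) ≡ odd m xor odd n
odd-+ zero    n = refl
odd-+ (suc m) n = trans (cong not (odd-+ m n)) (not-distribˡ-xor (odd m) (odd n))

odd-* : ∀ m n → odd (m * n) ≡ odd m ∧ odd n
odd-* zero    n = refl
odd-* (suc m) n = begin
  odd (n + m * n)           ≡⟨ odd-+ n (m * n) ⟩
  odd n xor odd (m * n)     ≡⟨ cong (odd n xor_) (odd-* m n) ⟩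
  odd n xor (odd m ∧ odd n) ≡⟨ lemma (odd m) (odd n) ⟩
  not (odd m) ∧ odd n       ∎
  where
  open ≡-Reasoning
  lemma : ∀ a b → b xor (a ∧ b) ≡ not a ∧ b
  lemma true  b = xor-same b
  lemma false b = xor-identityʳ b

odd-2* : ∀ j → odd (2 * j) ≡ false
odd-2* j = odd-* 2 j

-- Since (1 + x)² = 1 + x² over 𝔽₂, the squared odd factors and the even factors of ∏_{j odd} (1 + x^j) · ∏_j (1 + x^j)
-- recombine into the same product in x².
∏-odd-euler-double : ∀ d .{{_ : NonZero d}} N →
  ∏ odd (d *_) N (eulerProduct d N) ≗[≤ N ] ∏ odd ((d + d) *_) N (eulerProduct (d + d) N)
∏-odd-euler-double d N = ≗[≤]-trans (λ r r≤N → sym (extend r r≤N)) (≗[≤]-trans (≗⇒≗[≤] square) shrink)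
  where
  instance
    d+d≢0 : NonZero (d + d)
    d+d≢0 = >-nonZero (<-≤-trans (>-nonZero⁻¹ d) (m≤m+n d d))
  2N = 2 * N
  N≤2N : N ≤ 2N
  N≤2N = m≤n*m N 2
  large : ∀ c .{{_ : NonZero c}} i → N < i → i ≤ 2N → N < c * i
  large c i N<i _ = <-≤-trans N<i (m≤n*m i c)
  extend : ∏ odd (d *_) 2N (eulerProduct d 2N) ≗[≤ N ] ∏ odd (d *_) N (eulerProduct d N)
  extend = ≗[≤]-trans (∏-cong-≤ odd (d *_) 2N (∏-high (const true) (d *_) 𝟙 N≤2N (large d)))
                      (∏-high odd (d *_) (eulerProduct d N) N≤2N (large d))
  evens : ∏ (not ∘ odd) (d *_) 2N 𝟙 ≗ eulerProduct (d + d) N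
  evens = ≗-trans (∏-multiples 2 (d *_) 𝟙 odd-offset (λ j → cong not (odd-2* j)) N)
                  (∏-cong-exp (const true) N 𝟙 (doubling d))
    where
    odd-offset : ∀ j s → 0 < s → s < 2 → not (odd (2 * j + s)) ≡ false
    odd-offset j 1 _ _ = cong not (trans (odd-+ (2 * j) 1) (cong (_xor true) (odd-2* j)))
    odd-offset j (suc (suc s)) _ (s≤s (s≤s ()))
    doubling : ∀ d i → d * (2 * i) ≡ (d + d) * i
    doubling = solve-∀
  square : ∏ odd (d *_) 2N (eulerProduct d 2N) ≗ ∏ odd ((d + d) *_) 2N (eulerProduct (d + d) N)
  square = ≗-trans (∏-cong odd (d *_) 2N (≗-sym (∏-split odd (d *_) 2N 𝟙)))
          (≗-trans (∏-square odd (d *_) 2N (∏ (not ∘ odd) (d *_) 2N 𝟙))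
          (≗-trans (∏-cong-exp odd 2N _ (λ i → sym (*-distribʳ-+ i d d)))
                   (∏-cong odd ((d + d) *_) 2N evens)))
  shrink : ∏ odd ((d + d) *_) 2N (eulerProduct (d + d) N) ≗[≤ N ] ∏ odd ((d + d) *_) N (eulerProduct (d + d) N)
  shrink = ∏-high odd ((d + d) *_) _ N≤2N (large (d + d))

∏-odd-euler : ∀ d .{{_ : NonZero d}} N → ∏ odd (d *_) N (eulerProduct d N) ≗[≤ N ] 𝟙
∏-odd-euler d N = go N d (+-monoˡ-≤ N (>-nonZero⁻¹ d))
  where
  go : ∀ fuel d .{{_ : NonZero d}} → N < d + fuel → ∏ odd (d *_) N (eulerProduct d N) ≗[≤ N ] 𝟙
  go fuel d N<d+fuel with N <? d
  ... | yes N<d = ≗[≤]-trans (∏-high odd (d *_) (eulerProduct d N) z≤n large)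
                            (∏-high (const true) (d *_) 𝟙 z≤n large)
    where
    large : ∀ i → 0 < i → i ≤ N → N < d * i
    large i 0<i _ = <-≤-trans N<d (m≤m*n d i {{>-nonZero 0<i}})
  go zero       d N<d+0    | no N≮d = contradiction (subst (N <_) (+-identityʳ d) N<d+0) N≮d
  go (suc fuel) d N<d+fuel | no _   =
    ≗[≤]-trans (∏-odd-euler-double d N) (go fuel (d + d) {{d+d≢0}} (<-≤-trans N<d+fuel d+1+fuel≤2d+fuel))
    where
    d+d≢0 : NonZero (d + d)
    d+d≢0 = >-nonZero (<-≤-trans (>-nonZero⁻¹ d) (m≤m+n d d))
    d+1+fuel≤2d+fuel : d + suc fuel ≤ d + d + fuel
    d+1+fuel≤2d+fuel = begin
      d + suc fuel     ≡⟨ +-suc d fuel ⟩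
      1 + (d + fuel)   ≤⟨ +-monoˡ-≤ (d + fuel) (>-nonZero⁻¹ d) ⟩
      d + (d + fuel)   ≡⟨ +-assoc d d fuel ⟨
      d + d + fuel     ∎
      where open ≤-Reasoning

∏-avoiding-odd-multiples : ∀ α .{{_ : NonZero α}} A m →
  (∀ j s → 0 < s → s < α → A (α * j + s) ≡ true) → (∀ j → A (α * j) ≡ not (odd j)) →
  ∏ A id m 𝟙 ≗[≤ m ] eulerProduct 1 m ∗ eulerProduct α m
∏-avoiding-odd-multiples α A m off on = ≗[≤]-trans (∏-cong-≤ A id m (λ r r≤m → sym (oddMultiples r r≤m)))
                                         (≗⇒≗[≤] (≗-sym product))
  where
  product : eulerProduct 1 m ∗ eulerProduct α m ≗ ∏ A id m (∏ (not ∘ A) id m (eulerProduct α m))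
  product = ≗-trans (∏-∗ (const true) (1 *_) m 𝟙 (eulerProduct α m))
           (≗-trans (∏-cong (const true) (1 *_) m (𝟙-∗ (eulerProduct α m)))
           (≗-trans (∏-cong-exp (const true) m _ *-identityˡ)
                    (≗-sym (∏-split A id m (eulerProduct α m)))))
  oddMultiples : ∏ (not ∘ A) id m (eulerProduct α m) ≗[≤ m ] 𝟙
  oddMultiples = ≗[≤]-trans (λ r r≤m → sym (∏-high (not ∘ A) id _ (m≤n*m m α) (λ i m<i _ → m<i) r r≤m))
                (≗[≤]-trans (≗⇒≗[≤] (∏-multiples α id _ (λ j s 0<s s<α → cong not (off j s 0<s s<α))
                                                        (λ j → trans (cong not (on j)) (not-involutive (odd j))) m))
                            (∏-odd-euler α m))

-- Q, f_k and ⋆ modulo 2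

odd-∸ : ∀ m n → n ≤ m → odd (m ∸ n) ≡ odd m xor odd n
odd-∸ m n n≤m = begin
  odd (m ∸ n)                      ≡⟨ xor-identityʳ _ ⟨
  odd (m ∸ n) xor false            ≡⟨ cong (odd (m ∸ n) xor_) (xor-same (odd n)) ⟨
  odd (m ∸ n) xor (odd n xor odd n) ≡⟨ xor-assoc (odd (m ∸ n)) (odd n) (odd n) ⟨
  (odd (m ∸ n) xor odd n) xor odd n ≡⟨ cong (_xor odd n) (odd-+ (m ∸ n) n) ⟨
  odd (m ∸ n + n) xor odd n        ≡⟨ cong (λ k → odd k xor odd n) (m∸n+n≡m n≤m) ⟩
  odd m xor odd n                  ∎
  where open ≡-Reasoning

oddℤ : ℤ → Bool
oddℤ = odd ∘ ∣_∣

oddℤ-⊖ : ∀ m n → oddℤ (m ⊖ n) ≡ odd m xor odd n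
oddℤ-⊖ m n with n ≤? m
... | yes n≤m rewrite ℤ.⊖-≥ n≤m = odd-∸ m n n≤m
... | no  n≰m rewrite ℤ.⊖-< (≰⇒> n≰m) | ℤ.∣-i∣≡∣i∣ (+ (n ∸ m)) =
  trans (odd-∸ n m (<⇒≤ (≰⇒> n≰m))) (xor-comm (odd n) (odd m))

oddℤ-+ : ∀ a b → oddℤ (a ℤ.+ b) ≡ oddℤ a xor oddℤ b
oddℤ-+ (+ m)    (+ n)    = odd-+ m n
oddℤ-+ (+ m)    -[1+ n ] = oddℤ-⊖ m (suc n)
oddℤ-+ -[1+ m ] (+ n)    = trans (oddℤ-⊖ n (suc m)) (xor-comm (odd n) _)
oddℤ-+ -[1+ m ] -[1+ n ] = begin
  not (not (odd (m + n)))         ≡⟨ not-involutive _ ⟩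
  odd (m + n)                     ≡⟨ odd-+ m n ⟩
  odd m xor odd n                 ≡⟨ lemma (odd m) (odd n) ⟩
  not (odd m) xor not (odd n)     ∎
  where
  open ≡-Reasoning
  lemma : ∀ a b → a xor b ≡ not a xor not b
  lemma true  b = refl
  lemma false b = sym (not-involutive b)

oddℤ-* : ∀ a b → oddℤ (a ℤ.* b) ≡ oddℤ a ∧ oddℤ b
oddℤ-* a b = trans (cong odd (ℤ.abs-* a b)) (odd-* ∣ a ∣ ∣ b ∣)

oddℤ-- : ∀ a b → oddℤ (a ℤ.- b) ≡ oddℤ a xor oddℤ b
oddℤ-- a b = trans (oddℤ-+ a (ℤ.- b)) (cong (λ n → oddℤ a xor odd n) (ℤ.∣-i∣≡∣i∣ b))

odd≡false⇒2∣ : ∀ n → odd n ≡ false → 2 ℕ.∣ n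
odd≡false⇒2∣ zero          _      = 2 ℕ.∣0
odd≡false⇒2∣ (suc (suc n)) even =
  ℕ.∣m∣n⇒∣m+n (ℕ.∣-refl {2}) (odd≡false⇒2∣ n (trans (sym (not-involutive (odd n))) even))

oddℤ-≡⇒≡[mod2] : ∀ a b → oddℤ a ≡ oddℤ b → a ≡ b [mod 2 ]
oddℤ-≡⇒≡[mod2] a b same =
  odd≡false⇒2∣ ∣ a ℤ.- b ∣ (trans (oddℤ-- a b) (trans (cong (_xor oddℤ b) same) (xor-same (oddℤ b))))

oddℤ-⋆ : ∀ a b → oddℤ ∘ (a ⋆ b) ≗ (oddℤ ∘ a) ∗ (oddℤ ∘ b)
oddℤ-⋆ a b n = partial (suc n)
  where
  partial : ∀ k → oddℤ (convAux a b n k) ≡ ⨁[ i < k ] (oddℤ (a i) ∧ oddℤ (b (n ∸ i)))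
  partial zero    = refl
  partial (suc k) = trans (oddℤ-+ (convAux a b n k) (a k ℤ.* b (n ∸ k))) (cong₂ _xor_ (partial k) (oddℤ-* (a k) (b (n ∸ k))))

oddℤ-oneMinus : ∀ d .{{_ : NonZero d}} → oddℤ ∘ oneMinus d ≗ 𝟙 ⊕ shift d 𝟙
oddℤ-oneMinus d n with n ≟ 0 | n ≟ d
... | yes refl | _        = sym (cong (true xor_) (shift-< d 𝟙 (ℕ.>-nonZero⁻¹ d)))
... | no n≢0   | yes refl = sym (cong₂ _xor_ (trans (shift-𝟙 0 n) (dec-false (n ≟ 0) n≢0))
                                             (trans (shift-𝟙 d d) (dec-true (d ≟ d) refl)))
... | no n≢0   | no n≢d   = sym (cong₂ _xor_ (trans (shift-𝟙 0 n) (dec-false (n ≟ 0) n≢0))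
                                             (trans (shift-𝟙 d n) (dec-false (n ≟ d) n≢d)))

oddℤ-fprod : ∀ k .{{_ : NonZero k}} N → oddℤ ∘ fprod k N ≗ eulerProduct k N
oddℤ-fprod k zero    zero    = refl
oddℤ-fprod k zero    (suc n) = refl
oddℤ-fprod k (suc N) = ≗-trans (oddℤ-⋆ (fprod k N) (oneMinus (k * suc N)))
                      (≗-trans (∗-cong (oddℤ-fprod k N) (oddℤ-oneMinus (k * suc N) {{m*n≢0 k (suc N)}}))
                               (∗-[1+q^] (k * suc N) (eulerProduct k N)))

oddℤ-f : ∀ k .{{_ : NonZero k}} N → oddℤ ∘ f k ≗[≤ N ] eulerProduct k N
oddℤ-f k N n n≤N =
  trans (oddℤ-fprod k n n) (sym (∏-high (const true) (k *_) 𝟙 n≤N (λ i n<i _ → <-≤-trans n<i (m≤n*m i k)) n ≤-refl))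

allowedᵇ : ℕ → ℕ → ℕ → Bool
allowedᵇ t s m = does (allowed? t s m)

odd-cnt : ∀ t s M r → odd (cnt t s M r) ≡ ∏ (allowedᵇ t s) id M 𝟙 r
odd-cnt t s zero    zero    = refl
odd-cnt t s zero    (suc r) = refl
odd-cnt t s (suc m) r with allowed? t s (suc m) | suc m ≤? r
... | yes _ | yes m<r = trans (odd-+ (cnt t s m r) (cnt t s m (r ∸ suc m)))
                              (cong₂ _xor_ (odd-cnt t s m r) (trans (odd-cnt t s m (r ∸ suc m)) (sym (shift-≥ (suc m) _ m<r))))
... | yes _ | no  m≮r = trans (odd-cnt t s m r)
                              (sym (trans (cong (P r xor_) (shift-< (suc m) P (≰⇒> m≮r))) (xor-identityʳ (P r))))
  where P = ∏ (allowedᵇ t s) id m 𝟙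
... | no _  | _       = odd-cnt t s m r

allowedᵇ-cong : ∀ {t s m t' s' m'} →
  (+ m ≡ + s [mod t ]) ⇔ (+ m' ≡ + s' [mod t' ]) →
  (+ m ≡ + t ℤ.- + s [mod t ]) ⇔ (+ m' ≡ + t' ℤ.- + s' [mod t' ]) →
  allowedᵇ t s m ≡ allowedᵇ t' s' m'
allowedᵇ-cong {t} {s} {m} {t'} {s'} {m'} X⇔X' Y⇔Y' =
  does-⇔ (mk⇔ (λ ¬X⊎Y → ¬X⊎Y ∘ Sum.map (Equivalence.from X⇔X') (Equivalence.from Y⇔Y'))
              (λ ¬X'⊎Y' → ¬X'⊎Y' ∘ Sum.map (Equivalence.to X⇔X') (Equivalence.to Y⇔Y')))
         (allowed? t s m) (allowed? t' s' m')

∤⇒allowed : ∀ {t s m} → s ℕ.∣ t → ¬ s ℕ.∣ m → allowed t s m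
∤⇒allowed {t} {s} {m} s∣t s∤m t∣⋯ = s∤m (∣⇒∣ᵤ (case t∣⋯))
  where
  s∣t′ : + s ∣ˢ + t
  s∣t′ = ∣ᵤ⇒∣ s∣t
  sub-add : ∀ a b → a ℤ.- b ℤ.+ b ≡ a
  sub-add = ℤ-Solver.solve-∀
  case : (+ m ≡ + s [mod t ]) ⊎ (+ m ≡ + t ℤ.- + s [mod t ]) → + s ∣ˢ + m
  case (inj₁ t∣m-s)     = subst (+ s ∣ˢ_) (sub-add (+ m) (+ s))
                                 (∣m∣n⇒∣m+n (∣-trans s∣t′ (∣ᵤ⇒∣ {i = + m ℤ.- + s} t∣m-s)) ∣-refl)
  case (inj₂ t∣m-[t-s]) = subst (+ s ∣ˢ_) (sub-add (+ m) (+ t ℤ.- + s))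
                                 (∣m∣n⇒∣m+n (∣-trans s∣t′ (∣ᵤ⇒∣ {i = + m ℤ.- (+ t ℤ.- + s)} t∣m-[t-s]))
                                            (∣m∣n⇒∣m-n s∣t′ ∣-refl))

[mod]-scale : ∀ c .{{_ : NonZero c}} t a b → (+ c ℤ.* a ≡ + c ℤ.* b [mod t * c ]) ⇔ (a ≡ b [mod t ])
[mod]-scale c t a b = mk⇔ (λ tc∣ → ℕ.*-cancelʳ-∣ c (subst (t * c ℕ.∣_) ∣ca-cb∣≡∣a-b∣c tc∣))
                          (λ t∣ → subst (t * c ℕ.∣_) (sym ∣ca-cb∣≡∣a-b∣c) (ℕ.*-monoˡ-∣ c t∣))
  where
  factor : ∀ c a b → c ℤ.* a ℤ.- c ℤ.* b ≡ (a ℤ.- b) ℤ.* c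
  factor = ℤ-Solver.solve-∀
  ∣ca-cb∣≡∣a-b∣c : ∣ + c ℤ.* a ℤ.- + c ℤ.* b ∣ ≡ ∣ a ℤ.- b ∣ * c
  ∣ca-cb∣≡∣a-b∣c = trans (cong ∣_∣ (factor (+ c) a b)) (ℤ.abs-* (a ℤ.- b) (+ c))

[mod]-periodic : ∀ t m b → (+ (t + m) ≡ b [mod t ]) ⇔ (+ m ≡ b [mod t ])
[mod]-periodic t m b =
  mk⇔ (λ t∣ → ∣⇒∣ᵤ {i = + m ℤ.- b}
                  (∣m+n∣n⇒∣m (subst (+ t ∣ˢ_) rearrange (∣ᵤ⇒∣ {i = + (t + m) ℤ.- b} t∣)) ∣-refl))
      (λ t∣ → ∣⇒∣ᵤ (subst (+ t ∣ˢ_) (sym rearrange) (∣m∣n⇒∣m+n (∣ᵤ⇒∣ {i = + m ℤ.- b} t∣) ∣-refl)))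
  where
  identity : ∀ t m b → t ℤ.+ m ℤ.- b ≡ m ℤ.- b ℤ.+ t
  identity = ℤ-Solver.solve-∀
  rearrange : + (t + m) ℤ.- b ≡ + m ℤ.- b ℤ.+ + t
  rearrange = trans (cong (ℤ._- b) (ℤ.pos-+ t m)) (identity (+ t) (+ m) b)

allowedᵇ-4-1 : ∀ j → allowedᵇ 4 1 j ≡ not (odd j)
allowedᵇ-4-1 0 = refl
allowedᵇ-4-1 1 = refl
allowedᵇ-4-1 2 = refl
allowedᵇ-4-1 3 = refl
allowedᵇ-4-1 (suc (suc (suc (suc j)))) = begin
  allowedᵇ 4 1 (4 + j)
    ≡⟨ allowedᵇ-cong {4} {1} {4 + j} {4} {1} {j} ([mod]-periodic 4 j (+ 1)) ([mod]-periodic 4 j (+ 4 ℤ.- + 1)) ⟩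
  allowedᵇ 4 1 j
    ≡⟨ allowedᵇ-4-1 j ⟩
  not (odd j)
    ≡⟨ cong not (trans (not-involutive (odd (suc (suc j)))) (not-involutive (odd j))) ⟨
  not (odd (4 + j)) ∎
  where open ≡-Reasoning

allowedᵇ-multiple : ∀ α .{{_ : NonZero α}} j → allowedᵇ (4 * α) α (α * j) ≡ not (odd j)
allowedᵇ-multiple α j = trans (allowedᵇ-cong {4 * α} {α} {α * j} {4} {1} {j} X Y) (allowedᵇ-4-1 j)
  where
  X : (+ (α * j) ≡ + α [mod 4 * α ]) ⇔ (+ j ≡ + 1 [mod 4 ])
  X = subst₂ (λ a b → (a ≡ b [mod 4 * α ]) ⇔ (+ j ≡ + 1 [mod 4 ])) (sym (ℤ.pos-* α j)) (ℤ.*-identityʳ (+ α))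
             ([mod]-scale α 4 (+ j) (+ 1))
  identity : ∀ a → + 4 ℤ.* a ℤ.- a ≡ a ℤ.* (+ 4 ℤ.- + 1)
  identity = ℤ-Solver.solve-∀
  Y : (+ (α * j) ≡ + (4 * α) ℤ.- + α [mod 4 * α ]) ⇔ (+ j ≡ + 4 ℤ.- + 1 [mod 4 ])
  Y = subst₂ (λ a b → (a ≡ b [mod 4 * α ]) ⇔ (+ j ≡ + 4 ℤ.- + 1 [mod 4 ]))
             (sym (ℤ.pos-* α j)) (sym (trans (cong (ℤ._- + α) (ℤ.pos-* 4 α)) (identity (+ α))))
             ([mod]-scale α 4 (+ j) (+ 4 ℤ.- + 1))

allowedᵇ-nonmultiple : ∀ α .{{_ : NonZero α}} j s → 0 < s → s < α → allowedᵇ (4 * α) α (α * j + s) ≡ true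
allowedᵇ-nonmultiple α j s 0<s s<α = dec-true (allowed? (4 * α) α (α * j + s)) (∤⇒allowed (ℕ.n∣m*n 4) α∤αj+s)
  where
  α∤αj+s : ¬ α ℕ.∣ α * j + s
  α∤αj+s α∣ = <⇒≱ s<α (ℕ.∣⇒≤ {{>-nonZero 0<s}} (ℕ.∣m+n∣m⇒∣n α∣ (ℕ.m∣m*n j)))

-- Representations by x² + αy²

isRep : ℕ → ℕ → ℕ → ℕ → Bool
isRep α N x y = coprime6 x ∧ (coprime6 y ∧ does (x * x + α * (y * y) ≟ N))

repsBelow : ℕ → ℕ → ℕ → Bool
repsBelow α B N = ⨁[ x < B ] ⨁[ y < B ] isRep α N x y

reps : ℕ → ℕ → Bool
reps α N = repsBelow α (suc N) N

≟-sym : ∀ m n → does (m ≟ n) ≡ does (n ≟ m)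
≟-sym m n = does-⇔ (mk⇔ sym sym) (m ≟ n) (n ≟ m)

monomial-product : ∀ m a c → ⨁[ i < suc m ] (does (i ≟ a) ∧ does (m ∸ i ≟ c)) ≡ does (a + c ≟ m)
monomial-product m a c = begin
  ⨁[ i < suc m ] (does (i ≟ a) ∧ does (m ∸ i ≟ c))
    ≡⟨ ⨁-cong (suc m) (λ i _ → cong₂ _∧_ (shift-𝟙 a i) (shift-𝟙 c (m ∸ i))) ⟨
  (shift a 𝟙 ∗ shift c 𝟙) m
    ≡⟨ ∗-monomial c (shift a 𝟙) m ⟩
  shift c (shift a 𝟙) m
    ≡⟨ shift-shift c a 𝟙 m ⟩
  shift (c + a) 𝟙 m
    ≡⟨ shift-𝟙 (c + a) m ⟩
  does (m ≟ c + a)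
    ≡⟨ ≟-sym m (c + a) ⟩
  does (c + a ≟ m)
    ≡⟨ cong (λ k → does (k ≟ m)) (+-comm c a) ⟩
  does (a + c ≟ m) ∎
  where open ≡-Reasoning

representation-indicator : ∀ α m {x y a b} → x * x ≡ 24 * a + 1 → y * y ≡ 24 * b + 1 →
  does (x * x + α * (y * y) ≟ 24 * m + α + 1) ≡ does (a + α * b ≟ m)
representation-indicator α m {x} {y} {a} {b} x²≡ y²≡ = begin
  does (x * x + α * (y * y) ≟ 24 * m + α + 1)            ≡⟨ cong₂ (λ u v → does (u ≟ v)) lhs (+-assoc (24 * m) α 1) ⟩
  does (24 * (a + α * b) + (α + 1) ≟ 24 * m + (α + 1))    ≡⟨ ≟-affine 24 (α + 1) (a + α * b) m ⟩
  does (a + α * b ≟ m)                                    ∎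
  where
  open ≡-Reasoning
  identity : ∀ a b α → 24 * a + 1 + α * (24 * b + 1) ≡ 24 * (a + α * b) + (α + 1)
  identity = solve-∀
  lhs : x * x + α * (y * y) ≡ 24 * (a + α * b) + (α + 1)
  lhs = trans (cong₂ (λ u v → u + α * v) x²≡ y²≡) (identity a b α)

isRep-convolution : ∀ α m x y →
  ⨁[ i < suc m ] ((coprime6 x ∧ does (24 * i + 1 ≟ 1 * (x * x))) ∧ (coprime6 y ∧ does (24 * (m ∸ i) + α ≟ α * (y * y))))
    ≡ isRep α (24 * m + α + 1) x y
isRep-convolution α m x y = begin
  ⨁[ i < suc m ] ((coprime6 x ∧ E₁ i) ∧ (coprime6 y ∧ E₂ i))
    ≡⟨ ⨁-cong (suc m) (λ i _ → ∧-interchange (coprime6 x) (E₁ i) (coprime6 y) (E₂ i)) ⟩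
  ⨁[ i < suc m ] (coprime6 x ∧ (coprime6 y ∧ (E₁ i ∧ E₂ i)))
    ≡⟨ ∧-distribˡ-⨁ (suc m) (coprime6 x) _ ⟨
  coprime6 x ∧ ⨁[ i < suc m ] (coprime6 y ∧ (E₁ i ∧ E₂ i))
    ≡⟨ cong (coprime6 x ∧_) (∧-distribˡ-⨁ (suc m) (coprime6 y) _) ⟨
  coprime6 x ∧ (coprime6 y ∧ ⨁[ i < suc m ] (E₁ i ∧ E₂ i))
    ≡⟨ restrict (coprime6 x) (coprime6 y) id id ⟩
  isRep α (24 * m + α + 1) x y ∎
  where
  open ≡-Reasoning
  E₁ E₂ : ℕ → Bool
  E₁ i = does (24 * i + 1 ≟ 1 * (x * x))
  E₂ i = does (24 * (m ∸ i) + α ≟ α * (y * y))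
  ∧-interchange : ∀ a b c d → (a ∧ b) ∧ (c ∧ d) ≡ a ∧ (c ∧ (b ∧ d))
  ∧-interchange true  b true  d = refl
  ∧-interchange true  b false d = ∧-zeroʳ b
  ∧-interchange false b c     d = refl
  restrict : ∀ cx cy → (cx ≡ true → coprime6 x ≡ true) → (cy ≡ true → coprime6 y ≡ true) →
    cx ∧ (cy ∧ ⨁[ i < suc m ] (E₁ i ∧ E₂ i)) ≡ cx ∧ (cy ∧ does (x * x + α * (y * y) ≟ 24 * m + α + 1))
  restrict false _     _  _  = refl
  restrict true  false _  _  = refl
  restrict true  true  cx cy with coprime6-square x (cx refl) | coprime6-square y (cy refl)
  ... | a , x²≡ | b , y²≡ = begin
    ⨁[ i < suc m ] (E₁ i ∧ E₂ i)
      ≡⟨ ⨁-cong (suc m) (λ i _ → cong₂ _∧_ (square-indicator 1 i {x} x²≡) (square-indicator α (m ∸ i) {y} y²≡)) ⟩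
    ⨁[ i < suc m ] (does (i ≟ 1 * a) ∧ does (m ∸ i ≟ α * b))
      ≡⟨ monomial-product m (1 * a) (α * b) ⟩
    does (1 * a + α * b ≟ m)
      ≡⟨ cong (λ k → does (k + α * b ≟ m)) (*-identityˡ a) ⟩
    does (a + α * b ≟ m)
      ≡⟨ representation-indicator α m {x} {y} {a} {b} x²≡ y²≡ ⟨
    does (x * x + α * (y * y) ≟ 24 * m + α + 1) ∎

unitSquares-∗ : ∀ α B m → (unitSquareSeries 1 B ∗ unitSquareSeries α B) m ≡ repsBelow α B (24 * m + α + 1)
unitSquares-∗ α B m = begin
  ⨁[ i < suc m ] (unitSquareSeries 1 B i ∧ unitSquareSeries α B (m ∸ i))
    ≡⟨ ⨁-cong (suc m) (λ i _ → expand i) ⟩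
  ⨁[ i < suc m ] ⨁[ x < B ] ⨁[ y < B ] (X i x ∧ Y i y)
    ≡⟨ ⨁-comm (suc m) B _ ⟩
  ⨁[ x < B ] ⨁[ i < suc m ] ⨁[ y < B ] (X i x ∧ Y i y)
    ≡⟨ ⨁-cong B (λ x _ → ⨁-comm (suc m) B _) ⟩
  ⨁[ x < B ] ⨁[ y < B ] ⨁[ i < suc m ] (X i x ∧ Y i y)
    ≡⟨ ⨁-cong B (λ x _ → ⨁-cong B (λ y _ → isRep-convolution α m x y)) ⟩
  repsBelow α B (24 * m + α + 1) ∎
  where
  open ≡-Reasoning
  X Y : ℕ → ℕ → Bool
  X i x = coprime6 x ∧ does (24 * i + 1 ≟ 1 * (x * x))
  Y i y = coprime6 y ∧ does (24 * (m ∸ i) + α ≟ α * (y * y))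
  expand : ∀ i → unitSquareSeries 1 B i ∧ unitSquareSeries α B (m ∸ i) ≡ ⨁[ x < B ] ⨁[ y < B ] (X i x ∧ Y i y)
  expand i = trans (∧-distribʳ-⨁ B _ (X i)) (⨁-cong B (λ x _ → ∧-distribˡ-⨁ B (X i x) (Y i)))

n≤n*n : ∀ n → n ≤ n * n
n≤n*n zero    = z≤n
n≤n*n (suc n) = m≤m*n (suc n) (suc n)

isRep-≢ : ∀ α N x y → x * x + α * (y * y) ≢ N → isRep α N x y ≡ false
isRep-≢ α N x y ≢N = trans (cong (λ b → coprime6 x ∧ (coprime6 y ∧ b)) (dec-false (x * x + α * (y * y) ≟ N) ≢N))
                           (trans (cong (coprime6 x ∧_) (∧-zeroʳ (coprime6 y))) (∧-zeroʳ (coprime6 x)))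

repsBelow-bound : ∀ α .{{_ : NonZero α}} {B N} → N < B → repsBelow α B N ≡ reps α N
repsBelow-bound α {B} {N} N<B = trans (⨁-extend (suc N) B rowVanishes N<B)
                                      (⨁-cong (suc N) (λ x _ → ⨁-extend (suc N) B (columnVanishes x) N<B))
  where
  isRep-vanishes : ∀ {x y} → N < x ⊎ N < y → isRep α N x y ≡ false
  isRep-vanishes {x} {y} large = isRep-≢ α N x y (>⇒≢ (big large))
    where
    big : N < x ⊎ N < y → N < x * x + α * (y * y)
    big (inj₁ N<x) = <-≤-trans N<x (≤-trans (n≤n*n x) (m≤m+n _ _))
    big (inj₂ N<y) = <-≤-trans N<y (≤-trans (n≤n*n y) (≤-trans (m≤n*m (y * y) α) (m≤n+m _ _)))
  rowVanishes : ∀ x → suc N ≤ x → ⨁[ y < B ] isRep α N x y ≡ false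
  rowVanishes x N<x = ⨁-false B (λ y _ → isRep-vanishes {x} {y} (inj₁ N<x))
  columnVanishes : ∀ x y → suc N ≤ y → isRep α N x y ≡ false
  columnVanishes x y N<y = isRep-vanishes {x} {y} (inj₂ N<y)

eulerProducts-reps : ∀ α .{{_ : NonZero α}} m → (eulerProduct 1 m ∗ eulerProduct α m) m ≡ reps α (24 * m + α + 1)
eulerProducts-reps α m = begin
  (eulerProduct 1 m ∗ eulerProduct α m) m
    ≡⟨ ∗-cong-≤ (eulerProduct-unitSquares 1 m≤N) (eulerProduct-unitSquares α m≤N) m ≤-refl ⟩
  (unitSquareSeries 1 B ∗ unitSquareSeries α B) m
    ≡⟨ unitSquares-∗ α B m ⟩
  repsBelow α B N
    ≡⟨ repsBelow-bound α (<-≤-trans (n<1+n N) (m≤n*m (suc N) 6)) ⟩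
  reps α N ∎
  where
  open ≡-Reasoning
  N = 24 * m + α + 1
  B = 6 * suc N
  m≤N : m ≤ N
  m≤N = ≤-trans (m≤n*m m 24) (≤-trans (m≤m+n (24 * m) α) (m≤m+n _ 1))

Q-reps : ∀ α .{{_ : NonZero α}} m → odd (Q (4 * α) α m) ≡ reps α (24 * m + α + 1)
Q-reps α m = begin
  odd (cnt (4 * α) α m m)
    ≡⟨ odd-cnt (4 * α) α m m ⟩
  ∏ (allowedᵇ (4 * α) α) id m 𝟙 m
    ≡⟨ ∏-avoiding-odd-multiples α _ m (allowedᵇ-nonmultiple α) (allowedᵇ-multiple α) m ≤-refl ⟩
  (eulerProduct 1 m ∗ eulerProduct α m) m
    ≡⟨ eulerProducts-reps α m ⟩
  reps α (24 * m + α + 1) ∎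
  where open ≡-Reasoning

f₁fα-reps : ∀ α .{{_ : NonZero α}} m → oddℤ ((f 1 ⋆ f α) m) ≡ reps α (24 * m + α + 1)
f₁fα-reps α m = begin
  oddℤ ((f 1 ⋆ f α) m)                       ≡⟨ oddℤ-⋆ (f 1) (f α) m ⟩
  ((oddℤ ∘ f 1) ∗ (oddℤ ∘ f α)) m            ≡⟨ ∗-cong-≤ (oddℤ-f 1 m) (oddℤ-f α m) m ≤-refl ⟩
  (eulerProduct 1 m ∗ eulerProduct α m) m    ≡⟨ eulerProducts-reps α m ⟩
  reps α (24 * m + α + 1)                    ∎
  where open ≡-Reasoning

-- Primes p ≥ 5 with (−α/p) = −1

∤-prime⇒coprime : ∀ {p y} → Prime p → ¬ p ℕ.∣ y → Coprime y p
∤-prime⇒coprime p-prime p∤y (d∣y , d∣p) with prime⇒irreducible p-prime d∣p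
... | inj₁ d≡1  = d≡1
... | inj₂ refl = contradiction d∣y p∤y

inverse-mod-prime : ∀ {p y} → Prime p → ¬ p ℕ.∣ y → ∃[ s ] + p ∣ˢ s ℤ.* + y ℤ.- 1ℤ
inverse-mod-prime {p} {y} p-prime p∤y with coprime-Bézout (∤-prime⇒coprime p-prime p∤y)
... | Bézout.+- a b 1+bp≡ay = + a , dividesˢ (+ b) (begin
  + a ℤ.* + y ℤ.- 1ℤ           ≡⟨ cong (ℤ._- 1ℤ) (ℤ.pos-* a y) ⟨
  + (a * y) ℤ.- 1ℤ             ≡⟨ cong (λ n → + n ℤ.- 1ℤ) 1+bp≡ay ⟨
  + (1 + b * p) ℤ.- 1ℤ         ≡⟨ cong (ℤ._- 1ℤ) (trans (ℤ.pos-+ 1 (b * p)) (cong (λ z → 1ℤ ℤ.+ z) (ℤ.pos-* b p))) ⟩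
  1ℤ ℤ.+ + b ℤ.* + p ℤ.- 1ℤ    ≡⟨ cancel (+ b ℤ.* + p) ⟩
  + b ℤ.* + p                  ∎)
  where
  open ≡-Reasoning
  cancel : ∀ z → 1ℤ ℤ.+ z ℤ.- 1ℤ ≡ z
  cancel = ℤ-Solver.solve-∀
... | Bézout.-+ a b 1+ay≡bp = ℤ.- + a , dividesˢ (ℤ.- + b) (begin
  ℤ.- + a ℤ.* + y ℤ.- 1ℤ       ≡⟨ negate (+ a) (+ y) ⟩
  ℤ.- (1ℤ ℤ.+ + a ℤ.* + y)     ≡⟨ cong ℤ.-_ (trans (ℤ.pos-+ 1 (a * y)) (cong (λ z → 1ℤ ℤ.+ z) (ℤ.pos-* a y))) ⟨
  ℤ.- + (1 + a * y)            ≡⟨ cong (λ n → ℤ.- + n) 1+ay≡bp ⟩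
  ℤ.- + (b * p)                ≡⟨ cong ℤ.-_ (ℤ.pos-* b p) ⟩
  ℤ.- (+ b ℤ.* + p)            ≡⟨ ℤ.neg-distribˡ-* (+ b) (+ p) ⟩
  ℤ.- + b ℤ.* + p              ∎)
  where
  open ≡-Reasoning
  negate : ∀ a y → ℤ.- a ℤ.* y ℤ.- 1ℤ ≡ ℤ.- (1ℤ ℤ.+ a ℤ.* y)
  negate = ℤ-Solver.solve-∀

coprime6-*ˡ : ∀ {p} → ¬ 2 ℕ.∣ p → ¬ 3 ℕ.∣ p → ∀ x → coprime6 (p * x) ≡ coprime6 x
coprime6-*ˡ {p} 2∤p 3∤p x = cong₂ (λ a b → not a ∧ not b) (cancel prime[2] 2∤p) (cancel (from-yes (prime? 3)) 3∤p)
  where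
  cancel : ∀ {q} → Prime q → ¬ q ℕ.∣ p → does (q ℕ.∣? p * x) ≡ does (q ℕ.∣? x)
  cancel {q} q-prime q∤p =
    does-⇔ (mk⇔ (fromInj₂ (λ q∣p → contradiction q∣p q∤p) ∘ euclidsLemma p x q-prime) (ℕ.∣n⇒∣m*n p))
           (q ℕ.∣? p * x) (q ℕ.∣? x)

even-pow-≡1[24] : ∀ x s → x * x ≡ 24 * s + 1 → ∀ β → ∃[ t ] x ^ (2 * β) ≡ 24 * t + 1
even-pow-≡1[24] x s x²≡ zero    = 0 , refl
even-pow-≡1[24] x s x²≡ (suc β) with even-pow-≡1[24] x s x²≡ β
... | t , x^2β≡ = 24 * s * t + s + t , (begin
  x ^ (2 * suc β)                 ≡⟨ cong (x ^_) (*-suc 2 β) ⟩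
  x * (x * x ^ (2 * β))           ≡⟨ *-assoc x x _ ⟨
  x * x * x ^ (2 * β)             ≡⟨ cong₂ _*_ x²≡ x^2β≡ ⟩
  (24 * s + 1) * (24 * t + 1)     ≡⟨ expand s t ⟩
  24 * (24 * s * t + s + t) + 1   ∎)
  where
  open ≡-Reasoning
  expand : ∀ s t → (24 * s + 1) * (24 * t + 1) ≡ 24 * (24 * s * t + s + t) + 1
  expand = solve-∀

index-identity : ∀ α X P → ∃[ t ] P ≡ 24 * t + 1 → 24 * (X + (α + 1) * (P ∸ 1) / 24) + α + 1 ≡ 24 * X + (α + 1) * P
index-identity α X _ (t , refl) = begin
  24 * (X + (α + 1) * (24 * t + 1 ∸ 1) / 24) + α + 1   ≡⟨ cong (λ k → 24 * (X + k) + α + 1) quotient ⟩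
  24 * (X + (α + 1) * t) + α + 1                      ≡⟨ expand X α t ⟩
  24 * X + (α + 1) * (24 * t + 1)                     ∎
  where
  open ≡-Reasoning
  expand : ∀ X α t → 24 * (X + (α + 1) * t) + α + 1 ≡ 24 * X + (α + 1) * (24 * t + 1)
  expand = solve-∀
  reorder : ∀ a t → a * (24 * t) ≡ a * t * 24
  reorder = solve-∀
  quotient : (α + 1) * (24 * t + 1 ∸ 1) / 24 ≡ (α + 1) * t
  quotient = trans (cong (λ k → (α + 1) * k / 24) (m+n∸n≡m (24 * t) 1))
                   (trans (cong (_/ 24) (reorder (α + 1) t)) (m*n/n≡m ((α + 1) * t) 24))

module PrimeAtLeast5 {p} (p-prime : Prime p) (5≤p : 5 ≤ p) where

  instance
    p≢0 : NonZero p
    p≢0 = prime⇒nonZero p-prime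

  private
    ∤-prime : ∀ {d} → 2 ≤ d → d < 5 → ¬ d ℕ.∣ p
    ∤-prime {d} 2≤d d<5 d∣p with prime⇒irreducible p-prime d∣p
    ... | inj₁ refl = contradiction 2≤d (λ { (s≤s ()) })
    ... | inj₂ refl = <⇒≱ d<5 5≤p

    prime-∤ : ∀ {d} → 0 < d → d < 5 → ¬ p ℕ.∣ d
    prime-∤ 0<d d<5 p∣d = <⇒≱ d<5 (≤-trans 5≤p (ℕ.∣⇒≤ {{>-nonZero 0<d}} p∣d))

  2∤p : ¬ 2 ℕ.∣ p
  2∤p = ∤-prime ≤-refl (s≤s (s≤s (s≤s z≤n)))

  3∤p : ¬ 3 ℕ.∣ p
  3∤p = ∤-prime (s≤s (s≤s z≤n)) (s≤s (s≤s (s≤s (s≤s z≤n))))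

  prime-∤-24 : ¬ p ℕ.∣ 24
  prime-∤-24 p∣24 with euclidsLemma 4 6 p-prime p∣24
  ... | inj₁ p∣4 = prime-∤ (s≤s z≤n) (s≤s (s≤s (s≤s (s≤s (s≤s z≤n))))) p∣4
  ... | inj₂ p∣6 with euclidsLemma 2 3 p-prime p∣6
  ...   | inj₁ p∣2 = prime-∤ (s≤s z≤n) (s≤s (s≤s (s≤s z≤n))) p∣2
  ...   | inj₂ p∣3 = prime-∤ (s≤s z≤n) (s≤s (s≤s (s≤s (s≤s z≤n)))) p∣3

  ∤-offset : ∀ j s → 0 < s → s < p → ¬ p ℕ.∣ p * j + s
  ∤-offset j s 0<s s<p p∣ = <⇒≱ s<p (ℕ.∣⇒≤ {{>-nonZero 0<s}} (ℕ.∣m+n∣m⇒∣n p∣ (ℕ.m∣m*n j)))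

  ∤-index-odd : ∀ α n j → 1 ≤ j → j ≤ p ∸ 1 → ¬ p ℕ.∣ 24 * (p * n + j) + (α + 1) * p
  ∤-index-odd α n j 1≤j j≤p-1 p∣ =
    Sum.[ prime-∤-24 , p∤j ]′
      (euclidsLemma 24 j p-prime (ℕ.∣m+n∣m⇒∣n (subst (p ℕ.∣_) (rearrange p n j α) p∣) (ℕ.m∣m*n _)))
    where
    rearrange : ∀ p n j α → 24 * (p * n + j) + (α + 1) * p ≡ p * (24 * n + (α + 1)) + 24 * j
    rearrange = solve-∀
    p∤j : ¬ p ℕ.∣ j
    p∤j p∣j = <⇒≱ (m≤pred[n]⇒suc[m]≤n j≤p-1) (ℕ.∣⇒≤ {{>-nonZero 1≤j}} p∣j)

  coprime6-p : coprime6 p ≡ true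
  coprime6-p = cong₂ (λ a b → not a ∧ not b) (dec-false (2 ℕ.∣? p) 2∤p) (dec-false (3 ℕ.∣? p) 3∤p)

  pow-≡1[24] : ∀ β → ∃[ t ] p ^ (2 * β) ≡ 24 * t + 1
  pow-≡1[24] β with coprime6-square p coprime6-p
  ... | s , p²≡ = even-pow-≡1[24] p s p²≡ β

  index-even : ∀ α β n →
    24 * (p ^ (2 * β) * n + ((α + 1) * (p ^ (2 * β) ∸ 1)) / 24) + α + 1 ≡ p ^ (2 * β) * (24 * n + α + 1)
  index-even α β n = trans (index-identity α (P * n) P (pow-≡1[24] β)) (factor P n α)
    where
    P = p ^ (2 * β)
    factor : ∀ P n α → 24 * (P * n) + (α + 1) * P ≡ P * (24 * n + α + 1)
    factor = solve-∀

  index-odd : ∀ α β n j →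
    24 * (p ^ (2 * β + 1) * (p * n + j) + ((α + 1) * (p ^ (2 * β + 2) ∸ 1)) / 24) + α + 1
      ≡ p ^ (2 * β) * (p * (24 * (p * n + j) + (α + 1) * p))
  index-odd α β n j = trans (index-identity α (p ^ (2 * β + 1) * (p * n + j)) (p ^ (2 * β + 2)) p^[2β+2]≡1) regroup
    where
    p^[2β+2]≡1 : ∃[ t ] p ^ (2 * β + 2) ≡ 24 * t + 1
    p^[2β+2]≡1 = subst (λ k → ∃[ t ] p ^ k ≡ 24 * t + 1) (trans (*-suc 2 β) (+-comm 2 (2 * β))) (pow-≡1[24] (suc β))
    expand : ∀ P p n j α → 24 * (P * (p * 1) * (p * n + j)) + (α + 1) * (P * (p * (p * 1)))
                          ≡ P * (p * (24 * (p * n + j) + (α + 1) * p))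
    expand = solve-∀
    regroup : 24 * (p ^ (2 * β + 1) * (p * n + j)) + (α + 1) * p ^ (2 * β + 2)
                ≡ p ^ (2 * β) * (p * (24 * (p * n + j) + (α + 1) * p))
    regroup rewrite ^-distribˡ-+-* p (2 * β) 1 | ^-distribˡ-+-* p (2 * β) 2 = expand (p ^ (2 * β)) p n j α

module NonResidue {α p : ℕ} .{{_ : NonZero α}} (p-prime : Prime p) (5≤p : 5 ≤ p)
                  (nonresidue : LegendreIsMinusOne (- (+ α)) p) where

  open PrimeAtLeast5 p-prime 5≤p

  -- If s y ≡ 1 (mod p), then (sx)² + α = s²(x² + αy²) − α(sy − 1)(sy + 1).
  nonresidue-divides-y : ∀ x y → p ℕ.∣ x * x + α * (y * y) → p ℕ.∣ y
  nonresidue-divides-y x y p∣ with p ℕ.∣? y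
  ... | yes p∣y = p∣y
  ... | no  p∤y with inverse-mod-prime p-prime p∤y
  ...   | s , p∣sy-1 = contradiction (∣⇒∣ᵤ (subst (+ p ∣ˢ_) (identity s X Y A) p∣combination)) (nonresidue (s ℤ.* X))
    where
    X = + x
    Y = + y
    A = + α
    identity : ∀ s X Y A → s ℤ.* s ℤ.* (X ℤ.* X ℤ.+ A ℤ.* (Y ℤ.* Y))
                             ℤ.- A ℤ.* ((s ℤ.* Y ℤ.- 1ℤ) ℤ.* (s ℤ.* Y ℤ.+ 1ℤ))
                           ≡ s ℤ.* X ℤ.* (s ℤ.* X) ℤ.- ℤ.- A
    identity = ℤ-Solver.solve-∀
    p∣x²+αy² : + p ∣ˢ X ℤ.* X ℤ.+ A ℤ.* (Y ℤ.* Y)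
    p∣x²+αy² = subst (+ p ∣ˢ_) (trans (ℤ.pos-+ (x * x) (α * (y * y)))
                                      (cong₂ ℤ._+_ (ℤ.pos-* x x) (trans (ℤ.pos-* α (y * y)) (cong (A ℤ.*_) (ℤ.pos-* y y)))))
                     (∣ᵤ⇒∣ p∣)
    p∣combination : + p ∣ˢ s ℤ.* s ℤ.* (X ℤ.* X ℤ.+ A ℤ.* (Y ℤ.* Y))
                             ℤ.- A ℤ.* ((s ℤ.* Y ℤ.- 1ℤ) ℤ.* (s ℤ.* Y ℤ.+ 1ℤ))
    p∣combination =
      ∣m∣n⇒∣m-n (∣n⇒∣m*n (s ℤ.* s) p∣x²+αy²) (∣n⇒∣m*n A (∣m⇒∣m*n (s ℤ.* Y ℤ.+ 1ℤ) p∣sy-1))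

  nonresidue-divides-x : ∀ x y → p ℕ.∣ x * x + α * (y * y) → p ℕ.∣ x
  nonresidue-divides-x x y p∣ = Sum.[ id , id ]′ (euclidsLemma x x p-prime p∣x²)
    where
    p∣αy² : p ℕ.∣ α * (y * y)
    p∣αy² = ℕ.∣n⇒∣m*n α (ℕ.∣m⇒∣m*n y (nonresidue-divides-y x y p∣))
    p∣x² : p ℕ.∣ x * x
    p∣x² = ℕ.∣m+n∣m⇒∣n (subst (p ℕ.∣_) (+-comm (x * x) (α * (y * y))) p∣) p∣αy²

  reps-vanish : ∀ {u} → ¬ p ℕ.∣ u → reps α (p * u) ≡ false
  reps-vanish {u} p∤u = ⨁-false (suc (p * u)) λ x _ → ⨁-false (suc (p * u)) λ y _ →
    isRep-≢ α (p * u) x y (λ eq → p∤u (divides-u eq (nonresidue-divides-x x y (p∣ x y eq))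
                                                     (nonresidue-divides-y x y (p∣ x y eq))))
    where
    p∣ : ∀ x y → x * x + α * (y * y) ≡ p * u → p ℕ.∣ x * x + α * (y * y)
    p∣ x y eq = subst (p ℕ.∣_) (sym eq) (ℕ.m∣m*n u)
    factor : ∀ a b α p → a * p * (a * p) + α * (b * p * (b * p)) ≡ p * ((a * a + α * (b * b)) * p)
    factor = solve-∀
    divides-u : ∀ {x y} → x * x + α * (y * y) ≡ p * u → p ℕ.∣ x → p ℕ.∣ y → p ℕ.∣ u
    divides-u eq (ℕ.divides a refl) (ℕ.divides b refl) =
      ℕ.divides (a * a + α * (b * b)) (*-cancelˡ-≡ u _ p (trans (sym eq) (factor a b α p)))

  isRep-scale : ∀ N x y → isRep α (p * p * N) (p * x) (p * y) ≡ isRep α N x y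
  isRep-scale N x y = cong₂ _∧_ (coprime6-*ˡ 2∤p 3∤p x) (cong₂ _∧_ (coprime6-*ˡ 2∤p 3∤p y)
    (does-⇔ (mk⇔ (λ eq → *-cancelˡ-≡ _ N (p * p) {{m*n≢0 p p}} (trans (sym (factor p x y α)) eq))
                 (λ eq → trans (factor p x y α) (cong (p * p *_) eq)))
            (p * x * (p * x) + α * (p * y * (p * y)) ≟ p * p * N) (x * x + α * (y * y) ≟ N)))
    where
    factor : ∀ p x y α → p * x * (p * x) + α * (p * y * (p * y)) ≡ p * p * (x * x + α * (y * y))
    factor = solve-∀

  -- Every representation of p²N has the form (px, py).
  reps-scale : ∀ N → reps α (p * p * N) ≡ reps α N
  reps-scale N = begin
    reps α M
      ≡⟨ repsBelow-bound α M<pK ⟨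
    ⨁[ x < p * K ] ⨁[ y < p * K ] isRep α M x y
      ≡⟨ ⨁-multiples p K _ (λ j s 0<s s<p → ⨁-false (p * K) (λ y _ → off-x j s 0<s s<p y)) ⟩
    ⨁[ x < K ] ⨁[ y < p * K ] isRep α M (p * x) y
      ≡⟨ ⨁-cong K (λ x _ → ⨁-multiples p K _ (λ j s 0<s s<p → off-y x j s 0<s s<p)) ⟩
    ⨁[ x < K ] ⨁[ y < K ] isRep α M (p * x) (p * y)
      ≡⟨ ⨁-cong K (λ x _ → ⨁-cong K (λ y _ → isRep-scale N x y)) ⟩
    repsBelow α K N
      ≡⟨ repsBelow-bound α (≤-trans (s≤s (m≤n*m N p)) (≤-reflexive (+-comm 1 (p * N)))) ⟩
    reps α N ∎
    where
    open ≡-Reasoning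
    M = p * p * N
    K = p * N + 1
    M<pK : M < p * K
    M<pK = subst (M <_) (sym (expand p N)) (m<m+n M (>-nonZero⁻¹ p))
      where
      expand : ∀ p N → p * (p * N + 1) ≡ p * p * N + p
      expand = solve-∀
    p∣M : p ℕ.∣ M
    p∣M = ℕ.∣m⇒∣m*n N (ℕ.m∣m*n p)
    off-x : ∀ j s → 0 < s → s < p → ∀ y → isRep α M (p * j + s) y ≡ false
    off-x j s 0<s s<p y = isRep-≢ α M (p * j + s) y
      (λ eq → ∤-offset j s 0<s s<p (nonresidue-divides-x (p * j + s) y (subst (p ℕ.∣_) (sym eq) p∣M)))
    off-y : ∀ x j s → 0 < s → s < p → isRep α M (p * x) (p * j + s) ≡ false
    off-y x j s 0<s s<p = isRep-≢ α M (p * x) (p * j + s)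
      (λ eq → ∤-offset j s 0<s s<p (nonresidue-divides-y (p * x) (p * j + s) (subst (p ℕ.∣_) (sym eq) p∣M)))

  reps-scale-pow : ∀ β N → reps α (p ^ (2 * β) * N) ≡ reps α N
  reps-scale-pow zero    N = cong (reps α) (*-identityˡ N)
  reps-scale-pow (suc β) N = begin
    reps α (p ^ (2 * suc β) * N)       ≡⟨ cong (λ k → reps α (p ^ k * N)) (*-suc 2 β) ⟩
    reps α (p * (p * p ^ (2 * β)) * N) ≡⟨ cong (reps α) (regroup p (p ^ (2 * β)) N) ⟩
    reps α (p * p * (p ^ (2 * β) * N)) ≡⟨ reps-scale (p ^ (2 * β) * N) ⟩
    reps α (p ^ (2 * β) * N)           ≡⟨ reps-scale-pow β N ⟩
    reps α N                           ∎
    where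
    open ≡-Reasoning
    regroup : ∀ p P N → p * (p * P) * N ≡ p * p * (P * N)
    regroup = solve-∀

  Q-congruence : ∀ β n →
    + (Q (4 * α) α (p ^ (2 * β) * n + ((α + 1) * (p ^ (2 * β) ∸ 1)) / 24)) ≡ (f 1 ⋆ f α) n [mod 2 ]
  Q-congruence β n = oddℤ-≡⇒≡[mod2] (+ Q (4 * α) α m) ((f 1 ⋆ f α) n) (begin
    odd (Q (4 * α) α m)                         ≡⟨ Q-reps α m ⟩
    reps α (24 * m + α + 1)                     ≡⟨ cong (reps α) (index-even α β n) ⟩
    reps α (p ^ (2 * β) * (24 * n + α + 1))     ≡⟨ reps-scale-pow β (24 * n + α + 1) ⟩
    reps α (24 * n + α + 1)                     ≡⟨ f₁fα-reps α n ⟨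
    oddℤ ((f 1 ⋆ f α) n)                        ∎)
    where
    open ≡-Reasoning
    m = p ^ (2 * β) * n + ((α + 1) * (p ^ (2 * β) ∸ 1)) / 24

  Q-vanishing : ∀ β n j → 1 ≤ j → j ≤ p ∸ 1 →
    + 2 ∣ + (Q (4 * α) α (p ^ (2 * β + 1) * (p * n + j) + ((α + 1) * (p ^ (2 * β + 2) ∸ 1)) / 24))
  Q-vanishing β n j 1≤j j≤p-1 = odd≡false⇒2∣ (Q (4 * α) α m) (begin
    odd (Q (4 * α) α m)                         ≡⟨ Q-reps α m ⟩
    reps α (24 * m + α + 1)                     ≡⟨ cong (reps α) (index-odd α β n j) ⟩
    reps α (p ^ (2 * β) * (p * u))              ≡⟨ reps-scale-pow β (p * u) ⟩
    reps α (p * u)                              ≡⟨ reps-vanish (∤-index-odd α n j 1≤j j≤p-1) ⟩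
    false                                       ∎)
    where
    open ≡-Reasoning
    m = p ^ (2 * β + 1) * (p * n + j) + ((α + 1) * (p ^ (2 * β + 2) ∸ 1)) / 24
    u = 24 * (p * n + j) + (α + 1) * p

mainTheorem2 : (α p : ℕ) → 1 ≤ α → Prime p → 5 ≤ p →
  LegendreIsMinusOne (- (+ α)) p → (β : ℕ) →
    ((n : ℕ) → + (Q (4 * α) α (p ^ (2 * β) * n + ((α + 1) * (p ^ (2 * β) ∸ 1)) / 24))
                 ≡ (f 1 ⋆ f α) n [mod 2 ])
    × ((n j : ℕ) → 1 ≤ j → j ≤ p ∸ 1 →
        + 2 ∣ + (Q (4 * α) α (p ^ (2 * β + 1) * (p * n + j) + ((α + 1) * (p ^ (2 * β + 2) ∸ 1)) / 24)))
mainTheorem2 α p 1≤α p-prime 5≤p nonresidue β = Q-congruence β , Q-vanishing β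
  where
  instance
    α≢0 : NonZero α
    α≢0 = >-nonZero 1≤α
  open NonResidue p-prime 5≤p nonresidue
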